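{- Let $S=\{213,231,312,321\}$ and let $T(x)=\sum_{n\ge0}\frac{t_n(S)}{n!}x^n$. Then $T$ satisfies the differential equation $T'(x)=T(x)+e^{T(x)}$ (as formal power series) with initial condition $T(0)=0$.
   Context: A pattern of length $k$ is a permutation of $[k]$. A rooted tree on $[n]$ is an unordered tree on $n\ge1$ vertices with a distinguished root and vertices labeled bijectively by $[n]$ (so $t_0(S)=0$). An instance of $\pi$ is a sequence of vertices $v_1,\dots,v_k$ with $v_i$ a strict ancestor of $v_{i+1}$ and labels in the same relative order as $\pi$; a tree avoids $S$ if it has no instance of any pattern of $S$. $t_n(S)$ denotes the number of rooted trees on $[n]$ avoiding $S$. -}

module Defs where

open import Data.Nat as ℕ using (ℕ; zero; suc; _<ᵇ_; _!)
open import Data.Nat.Properties using (_!≢0)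
open import Data.Bool using (Bool; true; false; _∧_; if_then_else_)
open import Data.Bool.Properties renaming (_≟_ to _≟ᵇ_)
open import Data.Maybe using (Maybe; just; nothing)
open import Data.Fin using (Fin; toℕ)
open import Data.Fin.Properties using () renaming (_≟_ to _≟ᶠ_)
open import Data.Vec using (Vec; lookup)
import Data.Vec as Vec
open import Data.List using (List; []; _∷_; length; filter; upTo; concatMap; map; cartesianProduct; zip)
open import Data.Bool.ListAction using (any; all)
open import Data.Product using (_×_; _,_)
open import Relation.Nullary.Decidable using (does)
open import Data.Integer using (+_)
open import Data.Rational using (ℚ; _+_; _*_; _/_; 0ℚ; 1ℚ)
import Data.Rational as ℚ

-- Vertex v : Fin n carries label toℕ v + 1, so labels are [n] and the
-- order on labels is the order on Fin n.
-- A rooted (unordered) tree on [n] is encoded by its parent vector: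
-- par[v] = nothing  iff v is the root, otherwise par[v] = just (parent of v).

Parents : ℕ → Set
Parents n = Vec (Maybe (Fin n)) n

iter : ∀ {n} → Parents n → ℕ → Fin n → Maybe (Fin n)
iter p zero    v = just v
iter p (suc k) v with iter p k v
... | nothing = nothing
... | just w  = lookup p w

roots : ∀ {n} → Parents n → ℕ
roots {n} p = length (filter (λ v → Data.Maybe.is-nothing (lookup p v) Data.Bool.≟ true) (Data.List.allFin n))
  where import Data.Maybe

-- p is (the parent vector of) a rooted tree: exactly one root, and every
-- vertex reaches "above the root" after n steps (i.e. no cycles).
isRootedTree : ∀ {n} → Parents n → Bool
isRootedTree {n} p =
  does (roots p ℕ.≟ 1) ∧ all (λ v → Data.Maybe.is-nothing (iter p n v)) (Data.List.allFin n)
  where import Data.Maybe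

eqMaybeFin : ∀ {n} → Maybe (Fin n) → Fin n → Bool
eqMaybeFin nothing  u = false
eqMaybeFin (just w) u = does (w ≟ᶠ u)

strictAncestor : ∀ {n} → Parents n → Fin n → Fin n → Bool
strictAncestor {n} p u v = any (λ k → eqMaybeFin (iter p (suc k) v) u) (upTo n)

-- Patterns.  A pattern of length k is a permutation of [k], written as
-- its one-line word (a list of naturals).

Pattern : Set
Pattern = List ℕ

chain : ∀ {n} → Parents n → List (Fin n) → Bool
chain p []            = true
chain p (u ∷ [])      = true
chain p (u ∷ v ∷ vs)  = strictAncestor p u v ∧ chain p (v ∷ vs)

sameOrder : ∀ {n} → Pattern → List (Fin n) → Bool
sameOrder π vs =
  all (λ { ((a , u) , (b , w)) → does ((a <ᵇ b) ≟ᵇ (toℕ u <ᵇ toℕ w)) })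
      (cartesianProduct (zip π vs) (zip π vs))

seqs : ∀ n → ℕ → List (List (Fin n))
seqs n zero    = [] ∷ []
seqs n (suc k) = concatMap (λ v → map (v ∷_) (seqs n k)) (Data.List.allFin n)

contains : ∀ {n} → Parents n → Pattern → Bool
contains {n} p π = any (λ vs → chain p vs ∧ sameOrder π vs) (seqs n (length π))

avoids : ∀ {n} → Parents n → List Pattern → Bool
avoids p S = all (λ π → Data.Bool.not (contains p π)) S

allParents : ∀ n m → List (Vec (Maybe (Fin n)) m)
allParents n zero    = Vec.[] ∷ []
allParents n (suc m) =
  concatMap (λ x → map (x Vec.∷_) (allParents n m)) (nothing ∷ map just (Data.List.allFin n))

t : List Pattern → ℕ → ℕ
t S n = length (filter (λ p → isRootedTree p ∧ avoids p S Data.Bool.≟ true) (allParents n n))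

S₀ : List Pattern
S₀ = (2 ∷ 1 ∷ 3 ∷ []) ∷ (2 ∷ 3 ∷ 1 ∷ []) ∷ (3 ∷ 1 ∷ 2 ∷ []) ∷ (3 ∷ 2 ∷ 1 ∷ []) ∷ []

Series : Set
Series = ℕ → ℚ

sumTo : ℕ → (ℕ → ℚ) → ℚ
sumTo zero    f = f 0
sumTo (suc n) f = sumTo n f + f (suc n)

_⊗_ : Series → Series → Series
(f ⊗ g) n = sumTo n (λ i → f i * g (n ℕ.∸ i))

_^^_ : Series → ℕ → Series
f ^^ zero  = λ n → if does (n ℕ.≟ 0) then 1ℚ else 0ℚ
f ^^ suc k = f ⊗ (f ^^ k)

_⊕_ : Series → Series → Series
(f ⊕ g) n = f n + g n

D : Series → Series
D f n = (+ suc n / 1) * f (suc n)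

-- e^{f} = Σ_k f^k / k!, for f with zero constant term (then only k ≤ n
-- contribute to the coefficient of x^n).
expS : Series → Series
expS f n = sumTo n (λ k → ((+ 1) / (k !)) {{k !≢0}} * (f ^^ k) n)

egf : (ℕ → ℕ) → Series
egf a n = ((+ a n) / (n !)) {{n !≢0}}

{-# OPTIONS --safe #-}
-- S = {213, 231, 312, 321} consists of the patterns of length 3 not starting with their smallest
-- letter, so a forest avoids S iff u has the smallest label whenever u is a strict ancestor of v and
-- v one of w.  Let f(n, K) count such forests on [n] with K trees and remove the vertex labelled 1:
-- either it is a root whose children are any r − K of the r roots of the remaining forest, or it is
-- a leaf directly below one of its K + 1 roots.  Hence
--   f(n + 1, K + 1) = (K + 1) f(n, K + 1) + Σ_r C(r, K) f(n, r),
-- and by induction on n this gives f(n, K)/n! = [xⁿ] T^K/K! for T = Σ_n f(n, 1) xⁿ/n!.  For K = 1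
-- the recurrence reads (n + 1)[xⁿ⁺¹]T = [xⁿ]T + Σ_r [xⁿ] T^r/r!, which is T′ = T + e^T.
module Submission where

open import Defs
open import Data.Rational using (0ℚ)
open import Relation.Binary.PropositionalEquality using (_≡_)
open import Data.Product using (_×_)

open import Data.Nat using (ℕ; zero; suc; _∸_; _≤_; _<_; _<ᵇ_; z≤n; s≤s; _!; NonZero)
import Data.Nat as ℕ
import Data.Nat.Properties as ℕ
open import Data.Nat.Properties using (_!≢0; _!*_!≢0)
open import Data.Product using (∃-syntax; _,_; proj₁; proj₂)
open import Data.Sum using (_⊎_; inj₁; inj₂)
open import Data.Empty using (⊥; ⊥-elim)
open import Function using (_∘_; id)
open import Relation.Nullary using (¬_; Dec; yes; no)
open import Relation.Binary.PropositionalEquality using (refl; sym; trans; cong; cong₂; subst; _≢_; module ≡-Reasoning)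
open ≡-Reasoning
open import Data.Nat.Induction using (<-rec)
open import Data.Fin using (Fin; zero; suc; toℕ)
import Data.Fin.Properties as Fin
open import Data.Maybe using (Maybe; just; nothing; _>>=_; is-nothing)
open import Data.Maybe.Properties using (just-injective)
open import Data.Vec using (Vec; lookup; []; _∷_)
open import Data.Bool using (Bool; true; false; T; not; _∧_; if_then_else_)
open import Data.Bool.Properties using (T-∧; T-≡) renaming (_≟_ to _≟ᵇ_)
open import Data.Bool.ListAction using (any; all)
open import Data.List using (List; []; _∷_; allFin; upTo; map; concatMap)
open import Data.List.Relation.Unary.Any using (Any; here)
import Data.List.Relation.Unary.Any.Properties as Any
open import Data.List.Relation.Unary.All using (All; []; _∷_)
import Data.List.Relation.Unary.All.Properties as All
open import Relation.Nullary.Decidable using (does; dec-true; dec-false)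
open import Function.Bundles using (module Equivalence)
open import Relation.Binary.Definitions using (Tri; tri<; tri≈; tri>)


module NaturalSums where

  open import Data.Nat using (_+_; _*_)
  open import Data.List using (_++_; concat; filter; length; tabulate)
  open import Data.Nat.Solver using (module +-*-Solver)
  open +-*-Solver

  private variable
    A B : Set

  sumToℕ : ℕ → (ℕ → ℕ) → ℕ
  sumToℕ zero    f = f 0
  sumToℕ (suc n) f = sumToℕ n f + f (suc n)

  sumToℕ-cong : ∀ n {f g : ℕ → ℕ} → (∀ i → f i ≡ g i) → sumToℕ n f ≡ sumToℕ n g
  sumToℕ-cong zero    f≗g = f≗g 0
  sumToℕ-cong (suc n) f≗g = cong₂ _+_ (sumToℕ-cong n f≗g) (f≗g (suc n))

  sumToℕ-zero : ∀ N → sumToℕ N (λ _ → 0) ≡ 0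
  sumToℕ-zero zero    = refl
  sumToℕ-zero (suc N) = cong (_+ 0) (sumToℕ-zero N)

  sumToℕ-+ : ∀ c (f g : ℕ → ℕ) → sumToℕ c (λ j → f j + g j) ≡ sumToℕ c f + sumToℕ c g
  sumToℕ-+ zero    f g = refl
  sumToℕ-+ (suc c) f g rewrite sumToℕ-+ c f g =
    solve 4 (λ a b x y → (a :+ b) :+ (x :+ y) := (a :+ x) :+ (b :+ y)) refl (sumToℕ c f) (sumToℕ c g) (f (suc c)) (g (suc c))

  sumToℕ-suc-head : ∀ c (f : ℕ → ℕ) → sumToℕ (suc c) f ≡ f 0 + sumToℕ c (f ∘ suc)
  sumToℕ-suc-head zero    f = refl
  sumToℕ-suc-head (suc c) f = trans (cong (_+ f (suc (suc c))) (sumToℕ-suc-head c f)) (ℕ.+-assoc (f 0) _ _)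

  sumOver : List A → (A → ℕ) → ℕ
  sumOver []       f = 0
  sumOver (x ∷ xs) f = f x + sumOver xs f

  sumOver-cong : ∀ (xs : List A) {f g : A → ℕ} → (∀ x → f x ≡ g x) → sumOver xs f ≡ sumOver xs g
  sumOver-cong []       f≗g = refl
  sumOver-cong (x ∷ xs) f≗g = cong₂ _+_ (f≗g x) (sumOver-cong xs f≗g)

  sumOver-+ : ∀ (xs : List A) (f g : A → ℕ) → sumOver xs (λ x → f x + g x) ≡ sumOver xs f + sumOver xs g
  sumOver-+ []       f g = refl
  sumOver-+ (x ∷ xs) f g rewrite sumOver-+ xs f g =
    solve 4 (λ a b c d → (a :+ b) :+ (c :+ d) := (a :+ c) :+ (b :+ d)) refl (f x) (g x) (sumOver xs f) (sumOver xs g)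

  sumOver-zero : ∀ (xs : List A) → sumOver xs (λ _ → 0) ≡ 0
  sumOver-zero []       = refl
  sumOver-zero (x ∷ xs) = sumOver-zero xs

  sumOver-*ˡ : ∀ c (xs : List A) f → c * sumOver xs f ≡ sumOver xs (λ x → c * f x)
  sumOver-*ˡ c []       f = ℕ.*-zeroʳ c
  sumOver-*ˡ c (x ∷ xs) f = trans (ℕ.*-distribˡ-+ c (f x) (sumOver xs f)) (cong (c * f x +_) (sumOver-*ˡ c xs f))

  sumOver-++ : ∀ (xs ys : List A) f → sumOver (xs ++ ys) f ≡ sumOver xs f + sumOver ys f
  sumOver-++ []       ys f = refl
  sumOver-++ (x ∷ xs) ys f = trans (cong (f x +_) (sumOver-++ xs ys f)) (sym (ℕ.+-assoc (f x) _ _))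

  sumOver-map : ∀ (h : A → B) (xs : List A) f → sumOver (map h xs) f ≡ sumOver xs (f ∘ h)
  sumOver-map h []       f = refl
  sumOver-map h (x ∷ xs) f = cong (f (h x) +_) (sumOver-map h xs f)

  sumOver-concatMap : ∀ (h : A → List B) (xs : List A) f → sumOver (concatMap h xs) f ≡ sumOver xs (λ x → sumOver (h x) f)
  sumOver-concatMap h []       f = refl
  sumOver-concatMap h (x ∷ xs) f =
    trans (sumOver-++ (h x) (concat (map h xs)) f) (cong (sumOver (h x) f +_) (sumOver-concatMap h xs f))

  sumOver-swap : ∀ (xs : List A) (ys : List B) (f : A → B → ℕ) →
                 sumOver xs (λ x → sumOver ys (f x)) ≡ sumOver ys (λ y → sumOver xs (λ x → f x y))
  sumOver-swap []       ys f = sym (sumOver-zero ys)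
  sumOver-swap (x ∷ xs) ys f =
    trans (cong (sumOver ys (f x) +_) (sumOver-swap xs ys f)) (sym (sumOver-+ ys (f x) (λ y → sumOver xs (λ x′ → f x′ y))))

  sumOver-tabulate : ∀ n (h : Fin n → A) (f : A → ℕ) → sumOver (tabulate h) f ≡ sumOver (allFin n) (f ∘ h)
  sumOver-tabulate zero    h f = refl
  sumOver-tabulate (suc n) h f =
    cong (f (h zero) +_) (trans (sumOver-tabulate n (h ∘ suc) f) (sym (sumOver-tabulate n suc (f ∘ h))))

  sumOver-sumToℕ : ∀ (xs : List A) N (f : A → ℕ → ℕ) →
                   sumOver xs (λ x → sumToℕ N (f x)) ≡ sumToℕ N (λ r → sumOver xs (λ x → f x r))
  sumOver-sumToℕ xs zero    f = refl
  sumOver-sumToℕ xs (suc N) f =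
    trans (sumOver-+ xs (λ x → sumToℕ N (f x)) (λ x → f x (suc N))) (cong (_+ sumOver xs (λ x → f x (suc N))) (sumOver-sumToℕ xs N f))

  ind : Bool → ℕ → ℕ
  ind b c = if b then c else 0

  length-filter : ∀ {P : A → Set} (P? : ∀ x → Dec (P x)) (xs : List A) →
                  length (filter P? xs) ≡ sumOver xs (λ x → ind (does (P? x)) 1)
  length-filter P? []       = refl
  length-filter P? (x ∷ xs) with does (P? x)
  ... | true  = cong suc (length-filter P? xs)
  ... | false = length-filter P? xs

  ind-sumOver : ∀ (xs : List A) b (k : A → ℕ) → sumOver xs (λ x → ind b (k x)) ≡ ind b (sumOver xs k)
  ind-sumOver xs true  k = refl
  ind-sumOver xs false k = sumOver-zero xs

  ind-sumToℕ : ∀ b N (f : ℕ → ℕ) → ind b (sumToℕ N f) ≡ sumToℕ N (λ r → ind b (f r))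
  ind-sumToℕ true  N f = refl
  ind-sumToℕ false N f = sym (sumToℕ-zero N)

  ind-∧ : ∀ a b x → ind (a ∧ b) x ≡ ind a (ind b x)
  ind-∧ true  b x = refl
  ind-∧ false b x = refl

  ind-+ : ∀ b x y → ind b (x + y) ≡ ind b x + ind b y
  ind-+ true  x y = refl
  ind-+ false x y = refl

  ind-* : ∀ b x y → ind b (x * y) ≡ x * ind b y
  ind-* true  x y = refl
  ind-* false x y = sym (ℕ.*-zeroʳ x)

  ind-zero : ∀ b → ind b 0 ≡ 0
  ind-zero true  = refl
  ind-zero false = refl

  δ : ℕ → ℕ → ℕ
  δ K j = ind (does (j ℕ.≟ K)) 1

  δ-refl : ∀ K → δ K K ≡ 1
  δ-refl K = cong (λ b → ind b 1) (dec-true (K ℕ.≟ K) refl)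

  δ-≢ : ∀ {K j} → j ≢ K → δ K j ≡ 0
  δ-≢ {K} {j} j≢K = cong (λ b → ind b 1) (dec-false (j ℕ.≟ K) j≢K)

  sumToℕ-δ-out : ∀ N (f : ℕ → ℕ) K → N < K → sumToℕ N (λ j → f j * δ K j) ≡ 0
  sumToℕ-δ-out zero    f K N<K = trans (cong (f 0 *_) (δ-≢ (ℕ.<⇒≢ N<K))) (ℕ.*-zeroʳ (f 0))
  sumToℕ-δ-out (suc N) f K N<K =
    cong₂ _+_ (sumToℕ-δ-out N f K (ℕ.<-trans (ℕ.n<1+n N) N<K)) (trans (cong (f (suc N) *_) (δ-≢ (ℕ.<⇒≢ N<K))) (ℕ.*-zeroʳ (f (suc N))))

  sumToℕ-δ-in : ∀ N (f : ℕ → ℕ) K → K ≤ N → sumToℕ N (λ j → f j * δ K j) ≡ f K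
  sumToℕ-δ-in zero    f .zero z≤n = trans (cong (f 0 *_) (δ-refl 0)) (ℕ.*-identityʳ (f 0))
  sumToℕ-δ-in (suc N) f K K≤1+N with ℕ.m≤n⇒m<n∨m≡n K≤1+N
  ... | inj₁ K<1+N@(s≤s K≤N) =
    trans (cong₂ _+_ (sumToℕ-δ-in N f K K≤N) (trans (cong (f (suc N) *_) (δ-≢ (ℕ.>⇒≢ K<1+N))) (ℕ.*-zeroʳ (f (suc N)))))
          (ℕ.+-identityʳ (f K))
  ... | inj₂ refl =
    trans (cong₂ _+_ (sumToℕ-δ-out N f (suc N) (ℕ.n<1+n N)) (cong (f (suc N) *_) (δ-refl (suc N)))) (ℕ.*-identityʳ (f (suc N)))

module NatRational where

  open import Data.Integer as ℤ using (+_)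
  import Data.Integer.Properties as ℤ
  open import Data.Rational using (ℚ; 1ℚ; _+_; _*_; _/_; toℚᵘ)
  import Data.Rational.Properties as ℚ
  open import Data.Rational.Unnormalised as ℚᵘ using (mkℚᵘ; *≡*) renaming (_≃_ to _≃ᵘ_)
  import Data.Rational.Unnormalised.Properties as ℚᵘ
  open NaturalSums using (sumToℕ)

  fromℕ : ℕ → ℚ
  fromℕ n = + n / 1

  recip : (d : ℕ) → .{{NonZero d}} → ℚ
  recip d = + 1 / d

  -- Equalities in ℚ are checked on unnormalised representatives, where they are integer identities.
  private
    toℚᵘ-/ : ∀ m d → toℚᵘ (+ m / suc d) ≃ᵘ mkℚᵘ (+ m) d
    toℚᵘ-/ m d = ℚ.toℚᵘ-fromℚᵘ (mkℚᵘ (+ m) d)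

  fromℕ-homo-+ : ∀ m n → fromℕ (m ℕ.+ n) ≡ fromℕ m + fromℕ n
  fromℕ-homo-+ m n = ℚ.toℚᵘ-injective (ℚᵘ.≃-trans (toℚᵘ-/ (m ℕ.+ n) 0)
    (ℚᵘ.≃-sym (ℚᵘ.≃-trans (ℚ.toℚᵘ-homo-+ (fromℕ m) (fromℕ n))
      (ℚᵘ.≃-trans (ℚᵘ.+-cong (toℚᵘ-/ m 0) (toℚᵘ-/ n 0)) (*≡* integral)))))
    where
    integral : (+ m ℤ.* + 1 ℤ.+ + n ℤ.* + 1) ℤ.* + 1 ≡ + (m ℕ.+ n) ℤ.* + 1
    integral = begin
      (+ m ℤ.* + 1 ℤ.+ + n ℤ.* + 1) ℤ.* + 1 ≡⟨ ℤ.*-identityʳ _ ⟩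
      + m ℤ.* + 1 ℤ.+ + n ℤ.* + 1           ≡⟨ cong₂ ℤ._+_ (ℤ.*-identityʳ (+ m)) (ℤ.*-identityʳ (+ n)) ⟩
      + m ℤ.+ + n                           ≡⟨ ℤ.pos-+ m n ⟨
      + (m ℕ.+ n)                           ≡⟨ ℤ.*-identityʳ _ ⟨
      + (m ℕ.+ n) ℤ.* + 1                   ∎

  fromℕ-homo-* : ∀ m n → fromℕ (m ℕ.* n) ≡ fromℕ m * fromℕ n
  fromℕ-homo-* m n = ℚ.toℚᵘ-injective (ℚᵘ.≃-trans (toℚᵘ-/ (m ℕ.* n) 0)
    (ℚᵘ.≃-sym (ℚᵘ.≃-trans (ℚ.toℚᵘ-homo-* (fromℕ m) (fromℕ n))
      (ℚᵘ.≃-trans (ℚᵘ.*-cong (toℚᵘ-/ m 0) (toℚᵘ-/ n 0)) (*≡* (cong (ℤ._* + 1) (sym (ℤ.pos-* m n))))))))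

  /≡fromℕ*recip : ∀ m d → .{{_ : NonZero d}} → + m / d ≡ fromℕ m * recip d
  /≡fromℕ*recip m (suc d) = ℚ.toℚᵘ-injective (ℚᵘ.≃-trans (toℚᵘ-/ m d)
    (ℚᵘ.≃-sym (ℚᵘ.≃-trans (ℚ.toℚᵘ-homo-* (fromℕ m) (recip (suc d)))
      (ℚᵘ.≃-trans (ℚᵘ.*-cong (toℚᵘ-/ m 0) (toℚᵘ-/ 1 d))
        (*≡* (cong₂ ℤ._*_ (ℤ.*-identityʳ (+ m)) (cong (λ k → + suc k) (sym (ℕ.+-identityʳ d)))))))))

  fromℕ*recip≡1 : ∀ d → .{{_ : NonZero d}} → fromℕ d * recip d ≡ 1ℚ
  fromℕ*recip≡1 (suc d) = ℚ.toℚᵘ-injective (ℚᵘ.≃-trans (ℚ.toℚᵘ-homo-* (fromℕ (suc d)) (recip (suc d)))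
    (ℚᵘ.≃-trans (ℚᵘ.*-cong (toℚᵘ-/ (suc d) 0) (toℚᵘ-/ 1 d)) (*≡* integral)))
    where
    integral : (+ suc d ℤ.* + 1) ℤ.* + 1 ≡ + 1 ℤ.* + suc (d ℕ.+ 0)
    integral = begin
      (+ suc d ℤ.* + 1) ℤ.* + 1 ≡⟨ ℤ.*-identityʳ _ ⟩
      + suc d ℤ.* + 1           ≡⟨ ℤ.*-identityʳ _ ⟩
      + suc d                   ≡⟨ cong (λ k → + suc k) (ℕ.+-identityʳ d) ⟨
      + suc (d ℕ.+ 0)           ≡⟨ ℤ.*-identityˡ _ ⟨
      + 1 ℤ.* + suc (d ℕ.+ 0)   ∎

  recip-homo-* : ∀ a b → .{{_ : NonZero a}} → .{{_ : NonZero b}} →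
                 recip (a ℕ.* b) {{ℕ.m*n≢0 a b}} ≡ recip a * recip b
  recip-homo-* (suc a) (suc b) = ℚ.toℚᵘ-injective (ℚᵘ.≃-trans (toℚᵘ-/ 1 (b ℕ.+ a ℕ.* suc b))
    (ℚᵘ.≃-sym (ℚᵘ.≃-trans (ℚ.toℚᵘ-homo-* (recip (suc a)) (recip (suc b)))
      (ℚᵘ.≃-trans (ℚᵘ.*-cong (toℚᵘ-/ 1 a) (toℚᵘ-/ 1 b)) (*≡* refl)))))

  invFact : ℕ → ℚ
  invFact n = recip (n !) {{n !≢0}}

  fromℕ-homo-sum : ∀ n g → fromℕ (sumToℕ n g) ≡ sumTo n (fromℕ ∘ g)
  fromℕ-homo-sum zero    g = refl
  fromℕ-homo-sum (suc n) g = trans (fromℕ-homo-+ (sumToℕ n g) (g (suc n))) (cong (_+ fromℕ (g (suc n))) (fromℕ-homo-sum n g))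

module RationalSums where

  open import Data.Rational using (ℚ; _+_; _*_)
  import Data.Rational.Properties as ℚ
  open import Data.Rational.Solver using (module +-*-Solver)
  open +-*-Solver

  sumTo-cong : ∀ n {f g : ℕ → ℚ} → (∀ i → i ≤ n → f i ≡ g i) → sumTo n f ≡ sumTo n g
  sumTo-cong zero    f≗g = f≗g 0 z≤n
  sumTo-cong (suc n) f≗g = cong₂ _+_ (sumTo-cong n (λ i i≤n → f≗g i (ℕ.m≤n⇒m≤1+n i≤n))) (f≗g (suc n) ℕ.≤-refl)

  sumTo-zero : ∀ n (f : ℕ → ℚ) → (∀ i → i ≤ n → f i ≡ 0ℚ) → sumTo n f ≡ 0ℚ
  sumTo-zero zero    f f≗0 = f≗0 0 z≤n
  sumTo-zero (suc n) f f≗0 = cong₂ _+_ (sumTo-zero n f (λ i i≤n → f≗0 i (ℕ.m≤n⇒m≤1+n i≤n))) (f≗0 (suc n) ℕ.≤-refl)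

  sumTo-+ : ∀ n (f g : ℕ → ℚ) → sumTo n (λ i → f i + g i) ≡ sumTo n f + sumTo n g
  sumTo-+ zero    f g = refl
  sumTo-+ (suc n) f g = begin
    sumTo n (λ i → f i + g i) + (f (suc n) + g (suc n))
      ≡⟨ cong (_+ (f (suc n) + g (suc n))) (sumTo-+ n f g) ⟩
    (sumTo n f + sumTo n g) + (f (suc n) + g (suc n))
      ≡⟨ solve 4 (λ a b c d → (a :+ b) :+ (c :+ d) := (a :+ c) :+ (b :+ d)) refl
                 (sumTo n f) (sumTo n g) (f (suc n)) (g (suc n)) ⟩
    (sumTo n f + f (suc n)) + (sumTo n g + g (suc n)) ∎

  sumTo-*ˡ : ∀ n c (f : ℕ → ℚ) → c * sumTo n f ≡ sumTo n (λ i → c * f i)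
  sumTo-*ˡ zero    c f = refl
  sumTo-*ˡ (suc n) c f = trans (ℚ.*-distribˡ-+ c (sumTo n f) (f (suc n))) (cong (_+ (c * f (suc n))) (sumTo-*ˡ n c f))

  sumTo-*ʳ : ∀ n c (f : ℕ → ℚ) → sumTo n f * c ≡ sumTo n (λ i → f i * c)
  sumTo-*ʳ n c f = trans (ℚ.*-comm (sumTo n f) c) (trans (sumTo-*ˡ n c f) (sumTo-cong n (λ i _ → ℚ.*-comm c (f i))))

  sumTo-suc-head : ∀ n (f : ℕ → ℚ) → sumTo (suc n) f ≡ f 0 + sumTo n (f ∘ suc)
  sumTo-suc-head zero    f = refl
  sumTo-suc-head (suc n) f = trans (cong (_+ f (suc (suc n))) (sumTo-suc-head n f)) (ℚ.+-assoc (f 0) _ _)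

  sumTo-reverse : ∀ n (f : ℕ → ℚ) → sumTo n f ≡ sumTo n (λ i → f (n ∸ i))
  sumTo-reverse zero    f = refl
  sumTo-reverse (suc n) f = begin
    sumTo n f + f (suc n)                 ≡⟨ cong (_+ f (suc n)) (sumTo-reverse n f) ⟩
    sumTo n (λ i → f (n ∸ i)) + f (suc n) ≡⟨ ℚ.+-comm _ (f (suc n)) ⟩
    f (suc n) + sumTo n (λ i → f (n ∸ i)) ≡⟨ sumTo-suc-head n (λ i → f (suc n ∸ i)) ⟨
    sumTo (suc n) (λ i → f (suc n ∸ i))   ∎

  sumTo-extend : ∀ n d (f : ℕ → ℚ) → (∀ i → n < i → f i ≡ 0ℚ) → sumTo (d ℕ.+ n) f ≡ sumTo n f
  sumTo-extend n zero    f f≗0 = refl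
  sumTo-extend n (suc d) f f≗0 =
    trans (cong₂ _+_ (sumTo-extend n d f f≗0) (f≗0 (suc (d ℕ.+ n)) (s≤s (ℕ.m≤n+m n d)))) (ℚ.+-identityʳ _)

  sumTo-shift : ∀ c N (f : ℕ → ℚ) → (∀ i → i < c → f i ≡ 0ℚ) → sumTo (c ℕ.+ N) f ≡ sumTo N (λ m → f (c ℕ.+ m))
  sumTo-shift c zero f f≗0 = begin
    sumTo (c ℕ.+ 0) f ≡⟨ cong (λ k → sumTo k f) (ℕ.+-identityʳ c) ⟩
    sumTo c f         ≡⟨ last c f f≗0 ⟩
    f c               ≡⟨ cong f (ℕ.+-identityʳ c) ⟨
    f (c ℕ.+ 0)       ∎
    where
    last : ∀ c (f : ℕ → ℚ) → (∀ i → i < c → f i ≡ 0ℚ) → sumTo c f ≡ f c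
    last zero    f f≗0 = refl
    last (suc c) f f≗0 = trans (cong (_+ f (suc c)) (sumTo-zero c f (λ i i≤c → f≗0 i (s≤s i≤c)))) (ℚ.+-identityˡ _)
  sumTo-shift c (suc N) f f≗0 =
    trans (cong (λ k → sumTo k f) (ℕ.+-suc c N)) (cong₂ _+_ (sumTo-shift c N f f≗0) (cong f (sym (ℕ.+-suc c N))))

  sumTo-swap : ∀ n N (F : ℕ → ℕ → ℚ) → sumTo n (λ i → sumTo N (F i)) ≡ sumTo N (λ m → sumTo n (λ i → F i m))
  sumTo-swap zero    N F = refl
  sumTo-swap (suc n) N F = trans (cong (_+ sumTo N (F (suc n))) (sumTo-swap n N F)) (sym (sumTo-+ N _ _))

  sumTo-triangle : ∀ n (G : ℕ → ℕ → ℚ) →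
    sumTo n (λ s → sumTo s (G s)) ≡ sumTo n (λ i → sumTo (n ∸ i) (λ j → G (i ℕ.+ j) i))
  sumTo-triangle zero    G = refl
  sumTo-triangle (suc n) G = begin
    sumTo n (λ s → sumTo s (G s)) + (sumTo n (G (suc n)) + G (suc n) (suc n))
      ≡⟨ cong (_+ (sumTo n (G (suc n)) + G (suc n) (suc n))) (sumTo-triangle n G) ⟩
    Rows n + (sumTo n (G (suc n)) + G (suc n) (suc n))
      ≡⟨ ℚ.+-assoc (Rows n) _ _ ⟨
    (Rows n + sumTo n (G (suc n))) + G (suc n) (suc n)
      ≡⟨ cong (_+ G (suc n) (suc n)) (sumTo-+ n _ _) ⟨
    sumTo n (λ i → sumTo (n ∸ i) (λ j → G (i ℕ.+ j) i) + G (suc n) i) + G (suc n) (suc n)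
      ≡⟨ cong₂ _+_ (sumTo-cong n row) (cong (λ k → G k (suc n)) (ℕ.+-identityʳ (suc n))) ⟨
    sumTo n (λ i → sumTo (suc n ∸ i) (λ j → G (i ℕ.+ j) i)) + sumTo 0 (λ j → G (suc n ℕ.+ j) (suc n))
      ≡⟨ cong (λ k → sumTo n (λ i → sumTo (suc n ∸ i) (λ j → G (i ℕ.+ j) i)) + sumTo k (λ j → G (suc n ℕ.+ j) (suc n)))
              (ℕ.n∸n≡0 n) ⟨
    Rows (suc n) ∎
    where
    Rows : ℕ → ℚ
    Rows m = sumTo m (λ i → sumTo (m ∸ i) (λ j → G (i ℕ.+ j) i))
    row : ∀ i → i ≤ n → sumTo (suc n ∸ i) (λ j → G (i ℕ.+ j) i) ≡ sumTo (n ∸ i) (λ j → G (i ℕ.+ j) i) + G (suc n) i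
    row i i≤n rewrite ℕ.+-∸-assoc 1 i≤n =
      cong (λ k → sumTo (n ∸ i) (λ j → G (i ℕ.+ j) i) + G k i) (trans (ℕ.+-suc i (n ∸ i)) (cong suc (ℕ.m+[n∸m]≡n i≤n)))

module SeriesAlgebra where

  open import Data.Rational using (ℚ; 1ℚ; _+_; _*_)
  import Data.Rational.Properties as ℚ
  open import Data.Rational.Solver using (module +-*-Solver)
  open +-*-Solver
  open NatRational
  open RationalSums

  1ˢ : Series
  1ˢ = (λ _ → 0ℚ) ^^ 0

  ⊗-congʳ : ∀ n f {g g′ : Series} → (∀ i → i ≤ n → g i ≡ g′ i) → (f ⊗ g) n ≡ (f ⊗ g′) n
  ⊗-congʳ n f g≗g′ = sumTo-cong n (λ i i≤n → cong (f i *_) (g≗g′ (n ∸ i) (ℕ.m∸n≤m n i)))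

  ⊗-comm : ∀ n f g → (f ⊗ g) n ≡ (g ⊗ f) n
  ⊗-comm n f g = trans (sumTo-reverse n (λ i → f i * g (n ∸ i)))
    (sumTo-cong n (λ i i≤n → trans (cong (λ k → f (n ∸ i) * g k) (ℕ.m∸[m∸n]≡n i≤n)) (ℚ.*-comm (f (n ∸ i)) (g i))))

  ⊗-assoc : ∀ n f g h → ((f ⊗ g) ⊗ h) n ≡ (f ⊗ (g ⊗ h)) n
  ⊗-assoc n f g h = begin
    sumTo n (λ s → sumTo s (λ i → f i * g (s ∸ i)) * h (n ∸ s))
      ≡⟨ sumTo-cong n (λ s _ → sumTo-*ʳ s (h (n ∸ s)) _) ⟩
    sumTo n (λ s → sumTo s (λ i → f i * g (s ∸ i) * h (n ∸ s)))
      ≡⟨ sumTo-triangle n (λ s i → f i * g (s ∸ i) * h (n ∸ s)) ⟩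
    sumTo n (λ i → sumTo (n ∸ i) (λ j → f i * g (i ℕ.+ j ∸ i) * h (n ∸ (i ℕ.+ j))))
      ≡⟨ sumTo-cong n (λ i _ → sumTo-cong (n ∸ i) (λ j _ → term i j)) ⟩
    sumTo n (λ i → sumTo (n ∸ i) (λ j → f i * (g j * h (n ∸ i ∸ j))))
      ≡⟨ sumTo-cong n (λ i _ → sumTo-*ˡ (n ∸ i) (f i) _) ⟨
    sumTo n (λ i → f i * sumTo (n ∸ i) (λ j → g j * h (n ∸ i ∸ j))) ∎
    where
    term : ∀ i j → f i * g (i ℕ.+ j ∸ i) * h (n ∸ (i ℕ.+ j)) ≡ f i * (g j * h (n ∸ i ∸ j))
    term i j rewrite ℕ.m+n∸m≡n i j | sym (ℕ.∸-+-assoc n i j) = ℚ.*-assoc (f i) (g j) (h (n ∸ i ∸ j))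

  ⊗-identityˡ : ∀ n g → (1ˢ ⊗ g) n ≡ g n
  ⊗-identityˡ zero    g = ℚ.*-identityˡ (g 0)
  ⊗-identityˡ (suc n) g = begin
    sumTo (suc n) (λ i → 1ˢ i * g (suc n ∸ i))       ≡⟨ sumTo-suc-head n (λ i → 1ˢ i * g (suc n ∸ i)) ⟩
    1ℚ * g (suc n) + sumTo n (λ i → 0ℚ * g (n ∸ i))  ≡⟨ cong₂ _+_ (ℚ.*-identityˡ (g (suc n)))
                                                         (sumTo-zero n _ (λ i _ → ℚ.*-zeroˡ (g (n ∸ i)))) ⟩
    g (suc n) + 0ℚ                                   ≡⟨ ℚ.+-identityʳ (g (suc n)) ⟩
    g (suc n)                                        ∎

  ⊗-identityʳ : ∀ n g → (g ⊗ 1ˢ) n ≡ g n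
  ⊗-identityʳ n g = trans (⊗-comm n g 1ˢ) (⊗-identityˡ n g)

  ⊗-scaleʳ : ∀ n f c g → (f ⊗ (λ i → c * g i)) n ≡ c * (f ⊗ g) n
  ⊗-scaleʳ n f c g = trans (sumTo-cong n (λ i _ → solve 3 (λ a b d → a :* (b :* d) := b :* (a :* d)) refl (f i) c (g (n ∸ i))))
                           (sym (sumTo-*ˡ n c _))

  ⊗-distribˡ-⊕ : ∀ n f g h → (f ⊗ (g ⊕ h)) n ≡ (f ⊗ g) n + (f ⊗ h) n
  ⊗-distribˡ-⊕ n f g h = trans (sumTo-cong n (λ i _ → ℚ.*-distribˡ-+ (f i) (g (n ∸ i)) (h (n ∸ i)))) (sumTo-+ n _ _)

  ^^-+ : ∀ f i j n → (f ^^ (i ℕ.+ j)) n ≡ ((f ^^ i) ⊗ (f ^^ j)) n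
  ^^-+ f zero    j n = sym (⊗-identityˡ n (f ^^ j))
  ^^-+ f (suc i) j n = trans (⊗-congʳ n f (λ m _ → ^^-+ f i j m)) (sym (⊗-assoc n f (f ^^ i) (f ^^ j)))

  ^^-vanishes : ∀ f → f 0 ≡ 0ℚ → ∀ k n → n < k → (f ^^ k) n ≡ 0ℚ
  ^^-vanishes f f0≡0 (suc k) n n<k = sumTo-zero n _ term
    where
    term : ∀ i → i ≤ n → f i * (f ^^ k) (n ∸ i) ≡ 0ℚ
    term zero    _   = trans (cong (_* (f ^^ k) n) f0≡0) (ℚ.*-zeroˡ ((f ^^ k) n))
    term (suc i) i<n = trans (cong (f (suc i) *_) (^^-vanishes f f0≡0 k (n ∸ suc i)
        (ℕ.<-≤-trans (ℕ.∸-monoʳ-< (s≤s z≤n) i<n) (ℕ.<⇒≤pred n<k)))) (ℚ.*-zeroʳ (f (suc i)))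

  D-⊗ : ∀ n g h → D (g ⊗ h) n ≡ ((D g ⊗ h) ⊕ (g ⊗ D h)) n
  D-⊗ n g h = begin
    fromℕ (suc n) * sumTo (suc n) term
      ≡⟨ sumTo-*ˡ (suc n) (fromℕ (suc n)) term ⟩
    sumTo (suc n) (λ i → fromℕ (suc n) * term i)
      ≡⟨ sumTo-cong (suc n) split ⟩
    sumTo (suc n) (λ i → fromℕ i * term i + fromℕ (suc n ∸ i) * term i)
      ≡⟨ sumTo-+ (suc n) _ _ ⟩
    sumTo (suc n) (λ i → fromℕ i * term i) + sumTo (suc n) (λ i → fromℕ (suc n ∸ i) * term i)
      ≡⟨ cong₂ _+_ left right ⟩
    (D g ⊗ h) n + (g ⊗ D h) n ∎
    where
    term : ℕ → ℚ
    term i = g i * h (suc n ∸ i)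
    split : ∀ i → i ≤ suc n → fromℕ (suc n) * term i ≡ fromℕ i * term i + fromℕ (suc n ∸ i) * term i
    split i i≤n = trans (cong (λ k → fromℕ k * term i) (sym (ℕ.m+[n∸m]≡n i≤n)))
                        (trans (cong (_* term i) (fromℕ-homo-+ i (suc n ∸ i))) (ℚ.*-distribʳ-+ (term i) (fromℕ i) _))
    left : sumTo (suc n) (λ i → fromℕ i * term i) ≡ (D g ⊗ h) n
    left = begin
      sumTo (suc n) (λ i → fromℕ i * term i)                ≡⟨ sumTo-suc-head n (λ i → fromℕ i * term i) ⟩
      0ℚ * term 0 + sumTo n (λ i → fromℕ (suc i) * term (suc i))
        ≡⟨ cong (_+ sumTo n (λ i → fromℕ (suc i) * term (suc i))) (ℚ.*-zeroˡ (term 0)) ⟩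
      0ℚ + sumTo n (λ i → fromℕ (suc i) * term (suc i))      ≡⟨ ℚ.+-identityˡ _ ⟩
      sumTo n (λ i → fromℕ (suc i) * term (suc i))
        ≡⟨ sumTo-cong n (λ i _ → ℚ.*-assoc (fromℕ (suc i)) (g (suc i)) (h (n ∸ i))) ⟨
      (D g ⊗ h) n                                           ∎
    right : sumTo (suc n) (λ i → fromℕ (suc n ∸ i) * term i) ≡ (g ⊗ D h) n
    right = begin
      sumTo n (λ i → fromℕ (suc n ∸ i) * term i) + fromℕ (n ∸ n) * (g (suc n) * h (n ∸ n))
        ≡⟨ cong (λ k → sumTo n (λ i → fromℕ (suc n ∸ i) * term i) + fromℕ k * (g (suc n) * h k)) (ℕ.n∸n≡0 n) ⟩
      sumTo n (λ i → fromℕ (suc n ∸ i) * term i) + 0ℚ * (g (suc n) * h 0)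
        ≡⟨ cong (sumTo n (λ i → fromℕ (suc n ∸ i) * term i) +_) (ℚ.*-zeroˡ (g (suc n) * h 0)) ⟩
      sumTo n (λ i → fromℕ (suc n ∸ i) * term i) + 0ℚ   ≡⟨ ℚ.+-identityʳ _ ⟩
      sumTo n (λ i → fromℕ (suc n ∸ i) * term i)        ≡⟨ sumTo-cong n commute ⟩
      (g ⊗ D h) n                                       ∎
      where
      commute : ∀ i → i ≤ n → fromℕ (suc n ∸ i) * term i ≡ g i * D h (n ∸ i)
      commute i i≤n rewrite ℕ.+-∸-assoc 1 i≤n =
        solve 3 (λ a b c → a :* (b :* c) := b :* (a :* c)) refl (fromℕ (suc (n ∸ i))) (g i) (h (suc (n ∸ i)))

  D-^^ : ∀ f k n → D (f ^^ suc k) n ≡ fromℕ (suc k) * ((f ^^ k) ⊗ D f) n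
  D-^^ f zero n = begin
    fromℕ (suc n) * (f ⊗ 1ˢ) (suc n) ≡⟨ cong (fromℕ (suc n) *_) (⊗-identityʳ (suc n) f) ⟩
    D f n                             ≡⟨ ⊗-identityˡ n (D f) ⟨
    (1ˢ ⊗ D f) n                      ≡⟨ ℚ.*-identityˡ _ ⟨
    1ℚ * (1ˢ ⊗ D f) n                 ∎
  D-^^ f (suc k) n = begin
    D (f ⊗ (f ^^ suc k)) n
      ≡⟨ D-⊗ n f (f ^^ suc k) ⟩
    (D f ⊗ (f ^^ suc k)) n + (f ⊗ D (f ^^ suc k)) n
      ≡⟨ cong₂ _+_ (⊗-comm n (D f) (f ^^ suc k)) (⊗-congʳ n f (λ m _ → D-^^ f k m)) ⟩
    X + (f ⊗ (λ m → fromℕ (suc k) * ((f ^^ k) ⊗ D f) m)) n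
      ≡⟨ cong (X +_) (⊗-scaleʳ n f (fromℕ (suc k)) ((f ^^ k) ⊗ D f)) ⟩
    X + fromℕ (suc k) * (f ⊗ ((f ^^ k) ⊗ D f)) n
      ≡⟨ cong (λ z → X + fromℕ (suc k) * z) (⊗-assoc n f (f ^^ k) (D f)) ⟨
    X + fromℕ (suc k) * X
      ≡⟨ solve 2 (λ x c → x :+ c :* x := (con 1ℚ :+ c) :* x) refl X (fromℕ (suc k)) ⟩
    (1ℚ + fromℕ (suc k)) * X
      ≡⟨ cong (_* X) (fromℕ-homo-+ 1 (suc k)) ⟨
    fromℕ (suc (suc k)) * X ∎
    where X = ((f ^^ suc k) ⊗ D f) n

module ExponentialFormula where

  open import Data.Nat.Combinatorics using (_C_; nCk≡n!/k![n-k]!; k![n∸k]!∣n!; k>n⇒nCk≡0)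
  open import Data.Nat.DivMod using (m/n*n≡m)
  open import Data.Rational using (ℚ; 1ℚ; _+_; _*_)
  import Data.Rational.Properties as ℚ
  open import Data.Rational.Solver using (module +-*-Solver)
  open +-*-Solver
  open NaturalSums using (sumToℕ; sumToℕ-cong)
  open NatRational
  open RationalSums
  open SeriesAlgebra

  C-*-factorials : ∀ k m → ((k ℕ.+ m) C k) ℕ.* (k ! ℕ.* m !) ≡ (k ℕ.+ m) !
  C-*-factorials k m = begin
    (N C k) ℕ.* (k ! ℕ.* m !)            ≡⟨ cong (λ j → (N C k) ℕ.* (k ! ℕ.* j !)) (ℕ.m+n∸m≡n k m) ⟨
    (N C k) ℕ.* (k ! ℕ.* (N ∸ k) !)      ≡⟨ cong (ℕ._* (k ! ℕ.* (N ∸ k) !)) (nCk≡n!/k![n-k]! k≤N) ⟩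
    (N ! ℕ./ (k ! ℕ.* (N ∸ k) !)) {{k !* (N ∸ k) !≢0}} ℕ.* (k ! ℕ.* (N ∸ k) !)
                                          ≡⟨ m/n*n≡m {{k !* (N ∸ k) !≢0}} (k![n∸k]!∣n! k≤N) ⟩
    N !                                   ∎
    where
    N = k ℕ.+ m
    k≤N = ℕ.m≤m+n k m

  invFact-suc : ∀ n → invFact (suc n) ≡ recip (suc n) * invFact n
  invFact-suc n = recip-homo-* (suc n) (n !) {{_}} {{n !≢0}}

  fromℕ*invFact-suc : ∀ k → fromℕ (suc k) * invFact (suc k) ≡ invFact k
  fromℕ*invFact-suc k = begin
    fromℕ (suc k) * invFact (suc k)                  ≡⟨ cong (fromℕ (suc k) *_) (invFact-suc k) ⟩
    fromℕ (suc k) * (recip (suc k) * invFact k)      ≡⟨ ℚ.*-assoc (fromℕ (suc k)) (recip (suc k)) (invFact k) ⟨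
    (fromℕ (suc k) * recip (suc k)) * invFact k      ≡⟨ cong (_* invFact k) (fromℕ*recip≡1 (suc k)) ⟩
    1ℚ * invFact k                                   ≡⟨ ℚ.*-identityˡ (invFact k) ⟩
    invFact k                                        ∎

  C*invFact : ∀ k m → fromℕ ((k ℕ.+ m) C k) * invFact (k ℕ.+ m) ≡ invFact k * invFact m
  C*invFact k m = begin
    c * invFact N
      ≡⟨ trans (cong₂ (λ u v → c * invFact N * u * v) (fromℕ*recip≡1 (k !) {{k !≢0}}) (fromℕ*recip≡1 (m !) {{m !≢0}}))
               (trans (ℚ.*-identityʳ _) (ℚ.*-identityʳ _)) ⟨
    c * invFact N * (fromℕ (k !) * invFact k) * (fromℕ (m !) * invFact m)
      ≡⟨ solve 6 (λ x ir a ia b ib → x :* ir :* (a :* ia) :* (b :* ib) := ((x :* (a :* b)) :* ir) :* (ia :* ib)) refl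
           c (invFact N) (fromℕ (k !)) (invFact k) (fromℕ (m !)) (invFact m) ⟩
    ((c * (fromℕ (k !) * fromℕ (m !))) * invFact N) * (invFact k * invFact m)
      ≡⟨ cong (λ u → (u * invFact N) * (invFact k * invFact m)) integral ⟩
    (fromℕ (N !) * invFact N) * (invFact k * invFact m)
      ≡⟨ cong (_* (invFact k * invFact m)) (fromℕ*recip≡1 (N !) {{N !≢0}}) ⟩
    1ℚ * (invFact k * invFact m)
      ≡⟨ ℚ.*-identityˡ _ ⟩
    invFact k * invFact m ∎
    where
    N = k ℕ.+ m
    c = fromℕ (N C k)
    integral : c * (fromℕ (k !) * fromℕ (m !)) ≡ fromℕ (N !)
    integral = trans (cong (c *_) (sym (fromℕ-homo-* (k !) (m !))))
                     (trans (sym (fromℕ-homo-* (N C k) (k ! ℕ.* m !))) (cong fromℕ (C-*-factorials k m)))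

  module _ (a : Series) (a0≡0 : a 0 ≡ 0ℚ) where

    expS-extend : ∀ n i → i ≤ n → expS a (n ∸ i) ≡ sumTo n (λ m → invFact m * (a ^^ m) (n ∸ i))
    expS-extend n i i≤n = sym (trans (cong (λ z → sumTo z (λ m → invFact m * (a ^^ m) (n ∸ i))) (sym (ℕ.m+[n∸m]≡n i≤n)))
                                     (sumTo-extend (n ∸ i) i _ vanish))
      where
      vanish : ∀ m → n ∸ i < m → invFact m * (a ^^ m) (n ∸ i) ≡ 0ℚ
      vanish m lt = trans (cong (invFact m *_) (^^-vanishes a a0≡0 m (n ∸ i) lt)) (ℚ.*-zeroʳ (invFact m))

    ^^-⊗-expS : ∀ K n → ((a ^^ K) ⊗ expS a) n ≡ sumTo n (λ m → invFact m * (a ^^ (K ℕ.+ m)) n)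
    ^^-⊗-expS K n = begin
      sumTo n (λ i → (a ^^ K) i * expS a (n ∸ i))
        ≡⟨ sumTo-cong n (λ i i≤n → cong ((a ^^ K) i *_) (expS-extend n i i≤n)) ⟩
      sumTo n (λ i → (a ^^ K) i * sumTo n (λ m → invFact m * (a ^^ m) (n ∸ i)))
        ≡⟨ sumTo-cong n (λ i _ → trans (sumTo-*ˡ n ((a ^^ K) i) _) (sumTo-cong n (λ m _ →
             solve 3 (λ x y z → x :* (y :* z) := y :* (x :* z)) refl ((a ^^ K) i) (invFact m) ((a ^^ m) (n ∸ i))))) ⟩
      sumTo n (λ i → sumTo n (λ m → invFact m * ((a ^^ K) i * (a ^^ m) (n ∸ i))))
        ≡⟨ sumTo-swap n n (λ i m → invFact m * ((a ^^ K) i * (a ^^ m) (n ∸ i))) ⟩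
      sumTo n (λ m → sumTo n (λ i → invFact m * ((a ^^ K) i * (a ^^ m) (n ∸ i))))
        ≡⟨ sumTo-cong n (λ m _ → trans (sym (sumTo-*ˡ n (invFact m) _)) (cong (invFact m *_) (sym (^^-+ a K m n)))) ⟩
      sumTo n (λ m → invFact m * (a ^^ (K ℕ.+ m)) n) ∎

    -- Reindexing r = K + m; the binomial coefficient vanishes for r < K.
    binomial-reindex : ∀ K n → invFact K * sumTo n (λ m → invFact m * (a ^^ (K ℕ.+ m)) n) ≡
                                sumTo n (λ r → fromℕ (r C K) * ((a ^^ r) n * invFact r))
    binomial-reindex K n = trans (sumTo-*ˡ n (invFact K) _) (trans (sumTo-cong n (λ m _ → reassoc m)) reindex)
      where
      G : ℕ → ℚ
      G m = (invFact K * invFact m) * (a ^^ (K ℕ.+ m)) n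
      h : ℕ → ℚ
      h r = fromℕ (r C K) * ((a ^^ r) n * invFact r)
      reassoc : ∀ m → invFact K * (invFact m * (a ^^ (K ℕ.+ m)) n) ≡ G m
      reassoc m = sym (ℚ.*-assoc (invFact K) (invFact m) _)
      G-vanish : ∀ m → n < K ℕ.+ m → G m ≡ 0ℚ
      G-vanish m lt = trans (cong (invFact K * invFact m *_) (^^-vanishes a a0≡0 (K ℕ.+ m) n lt)) (ℚ.*-zeroʳ (invFact K * invFact m))
      h-vanish : ∀ r → r < K → h r ≡ 0ℚ
      h-vanish r r<K = trans (cong (λ z → fromℕ z * ((a ^^ r) n * invFact r)) (k>n⇒nCk≡0 r<K)) (ℚ.*-zeroˡ ((a ^^ r) n * invFact r))
      h≡G : ∀ m → h (K ℕ.+ m) ≡ G m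
      h≡G m = trans (solve 3 (λ x y z → x :* (y :* z) := (x :* z) :* y) refl (fromℕ ((K ℕ.+ m) C K)) ((a ^^ (K ℕ.+ m)) n) (invFact (K ℕ.+ m)))
                    (cong (_* (a ^^ (K ℕ.+ m)) n) (C*invFact K m))
      reindex : sumTo n G ≡ sumTo n h
      reindex with K ℕ.≤? n
      ... | yes K≤n = begin
          sumTo n G                     ≡⟨ cong (λ z → sumTo z G) (ℕ.m+[n∸m]≡n K≤n) ⟨
          sumTo (K ℕ.+ (n ∸ K)) G       ≡⟨ sumTo-extend (n ∸ K) K G
                                             (λ m lt → G-vanish m (subst (_< K ℕ.+ m) (ℕ.m+[n∸m]≡n K≤n) (ℕ.+-monoʳ-< K lt))) ⟩
          sumTo (n ∸ K) G               ≡⟨ sumTo-cong (n ∸ K) (λ m _ → sym (h≡G m)) ⟩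
          sumTo (n ∸ K) (h ∘ (K ℕ.+_))  ≡⟨ sumTo-shift K (n ∸ K) h h-vanish ⟨
          sumTo (K ℕ.+ (n ∸ K)) h       ≡⟨ cong (λ z → sumTo z h) (ℕ.m+[n∸m]≡n K≤n) ⟩
          sumTo n h                     ∎
      ... | no K≰n = trans (sumTo-zero n G (λ m _ → G-vanish m (ℕ.<-≤-trans (ℕ.≰⇒> K≰n) (ℕ.m≤m+n K m))))
                           (sym (sumTo-zero n h (λ r r≤n → h-vanish r (ℕ.≤-<-trans r≤n (ℕ.≰⇒> K≰n)))))

    invFact*^^-⊗-expS : ∀ K n → invFact K * ((a ^^ K) ⊗ expS a) n ≡ sumTo n (λ r → fromℕ (r C K) * ((a ^^ r) n * invFact r))
    invFact*^^-⊗-expS K n = trans (cong (invFact K *_) (^^-⊗-expS K n)) (binomial-reindex K n)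

    -- Coefficientwise, (a^(K+1)/(K+1)!)′ = (a^K/K!) · a′ with a′ = a + e^a.
    D-^^-ode : ∀ n → (∀ i → i ≤ n → D a i ≡ (a ⊕ expS a) i) → ∀ K →
      D (a ^^ suc K) n * invFact (suc K) ≡
      fromℕ (suc K) * ((a ^^ suc K) n * invFact (suc K)) + sumTo n (λ r → fromℕ (r C K) * ((a ^^ r) n * invFact r))
    D-^^-ode n ode K = begin
      D (a ^^ suc K) n * invFact (suc K)
        ≡⟨ cong (_* invFact (suc K)) (D-^^ a K n) ⟩
      (fromℕ (suc K) * ((a ^^ K) ⊗ D a) n) * invFact (suc K)
        ≡⟨ cong (λ z → (fromℕ (suc K) * z) * invFact (suc K)) (trans (⊗-congʳ n (a ^^ K) ode) (⊗-distribˡ-⊕ n (a ^^ K) a (expS a))) ⟩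
      (fromℕ (suc K) * (((a ^^ K) ⊗ a) n + Y)) * invFact (suc K)
        ≡⟨ cong (λ z → (fromℕ (suc K) * (z + Y)) * invFact (suc K)) (⊗-comm n (a ^^ K) a) ⟩
      (fromℕ (suc K) * (A + Y)) * invFact (suc K)
        ≡⟨ solve 4 (λ c x y f → (c :* (x :+ y)) :* f := c :* (x :* f) :+ (c :* f) :* y) refl (fromℕ (suc K)) A Y (invFact (suc K)) ⟩
      fromℕ (suc K) * (A * invFact (suc K)) + (fromℕ (suc K) * invFact (suc K)) * Y
        ≡⟨ cong (λ z → fromℕ (suc K) * (A * invFact (suc K)) + z * Y) (fromℕ*invFact-suc K) ⟩
      fromℕ (suc K) * (A * invFact (suc K)) + invFact K * Y
        ≡⟨ cong (fromℕ (suc K) * (A * invFact (suc K)) +_) (invFact*^^-⊗-expS K n) ⟩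
      fromℕ (suc K) * (A * invFact (suc K)) + sumTo n (λ r → fromℕ (r C K) * ((a ^^ r) n * invFact r)) ∎
      where
      A = (a ^^ suc K) n
      Y = ((a ^^ K) ⊗ expS a) n

  -- F n K stands for the number of good forests on [n] with K trees.
  record ForestRecurrence (F : ℕ → ℕ → ℕ) : Set where
    field
      F-zero-zero : F 0 0 ≡ 1
      F-zero-suc  : ∀ K → F 0 (suc K) ≡ 0
      F-suc-zero  : ∀ n → F (suc n) 0 ≡ 0
      F-suc-suc   : ∀ n K → F (suc n) (suc K) ≡ suc K ℕ.* F n (suc K) ℕ.+ sumToℕ n (λ r → (r C K) ℕ.* F n r)

  module _ {F : ℕ → ℕ → ℕ} (rec : ForestRecurrence F) (trees : ℕ → ℕ) (trees≡F₁ : ∀ n → trees n ≡ F n 1) where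

    open ForestRecurrence rec

    private
      𝕋 : Series
      𝕋 = egf trees

    egf-trees : ∀ n → 𝕋 n ≡ fromℕ (F n 1) * invFact n
    egf-trees n = trans (/≡fromℕ*recip (trees n) (n !) {{n !≢0}}) (cong (λ z → fromℕ z * invFact n) (trees≡F₁ n))

    egf-trees-0 : 𝕋 0 ≡ 0ℚ
    egf-trees-0 = trans (egf-trees 0) (trans (cong (λ z → fromℕ z * invFact 0) (F-zero-suc 0)) (ℚ.*-zeroˡ (invFact 0)))

    ExponentialFormulaAt : ℕ → Set
    ExponentialFormulaAt n = ∀ K → fromℕ (F n K) * invFact n ≡ (𝕋 ^^ K) n * invFact K

    ode-at : ∀ n → ExponentialFormulaAt n → D 𝕋 n ≡ (𝕋 ⊕ expS 𝕋) n
    ode-at n formula = begin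
      fromℕ (suc n) * 𝕋 (suc n)
        ≡⟨ cong (fromℕ (suc n) *_) (egf-trees (suc n)) ⟩
      fromℕ (suc n) * (fromℕ (F (suc n) 1) * invFact (suc n))
        ≡⟨ solve 3 (λ c x f → c :* (x :* f) := x :* (c :* f)) refl (fromℕ (suc n)) (fromℕ (F (suc n) 1)) (invFact (suc n)) ⟩
      fromℕ (F (suc n) 1) * (fromℕ (suc n) * invFact (suc n))
        ≡⟨ cong₂ _*_ (cong fromℕ count) (fromℕ*invFact-suc n) ⟩
      fromℕ (F n 1 ℕ.+ sumToℕ n (F n)) * invFact n
        ≡⟨ cong (_* invFact n) (trans (fromℕ-homo-+ (F n 1) _) (cong (fromℕ (F n 1) +_) (fromℕ-homo-sum n (F n)))) ⟩
      (fromℕ (F n 1) + sumTo n (fromℕ ∘ F n)) * invFact n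
        ≡⟨ ℚ.*-distribʳ-+ (invFact n) (fromℕ (F n 1)) _ ⟩
      fromℕ (F n 1) * invFact n + sumTo n (fromℕ ∘ F n) * invFact n
        ≡⟨ cong₂ _+_ (sym (egf-trees n))
                     (trans (sumTo-*ʳ n (invFact n) _) (sumTo-cong n (λ r _ → trans (formula r) (ℚ.*-comm _ (invFact r))))) ⟩
      𝕋 n + expS 𝕋 n ∎
      where
      count : F (suc n) 1 ≡ F n 1 ℕ.+ sumToℕ n (F n)
      count = trans (F-suc-suc n 0) (cong₂ ℕ._+_ (ℕ.*-identityˡ (F n 1)) (sumToℕ-cong n (λ r → ℕ.*-identityˡ (F n r))))

    exponentialFormula-zero : ExponentialFormulaAt 0
    exponentialFormula-zero zero    rewrite F-zero-zero = refl
    exponentialFormula-zero (suc K) rewrite F-zero-suc K =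
      trans (ℚ.*-zeroˡ (invFact 0))
            (sym (trans (cong (_* invFact (suc K)) (^^-vanishes 𝕋 egf-trees-0 (suc K) 0 (s≤s z≤n))) (ℚ.*-zeroˡ (invFact (suc K)))))

    fromℕ-F-suc-suc : ∀ n K → fromℕ (F (suc n) (suc K)) ≡
      fromℕ (suc K) * fromℕ (F n (suc K)) + sumTo n (λ r → fromℕ (r C K) * fromℕ (F n r))
    fromℕ-F-suc-suc n K = begin
      fromℕ (F (suc n) (suc K))
        ≡⟨ cong fromℕ (F-suc-suc n K) ⟩
      fromℕ (suc K ℕ.* F n (suc K) ℕ.+ sumToℕ n (λ r → (r C K) ℕ.* F n r))
        ≡⟨ fromℕ-homo-+ (suc K ℕ.* F n (suc K)) _ ⟩
      fromℕ (suc K ℕ.* F n (suc K)) + fromℕ (sumToℕ n (λ r → (r C K) ℕ.* F n r))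
        ≡⟨ cong₂ _+_ (fromℕ-homo-* (suc K) (F n (suc K)))
                     (trans (fromℕ-homo-sum n _) (sumTo-cong n (λ r _ → fromℕ-homo-* (r C K) (F n r)))) ⟩
      fromℕ (suc K) * fromℕ (F n (suc K)) + sumTo n (λ r → fromℕ (r C K) * fromℕ (F n r)) ∎

    exponentialFormula-suc : ∀ n → (∀ i → i ≤ n → ExponentialFormulaAt i) → ExponentialFormulaAt (suc n)
    exponentialFormula-suc n ih zero rewrite F-suc-zero n = trans (ℚ.*-zeroˡ (invFact (suc n))) (sym (ℚ.*-zeroˡ (invFact 0)))
    exponentialFormula-suc n ih (suc K) = begin
      fromℕ (F (suc n) (suc K)) * invFact (suc n)
        ≡⟨ cong₂ _*_ (fromℕ-F-suc-suc n K) (invFact-suc n) ⟩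
      (fromℕ (suc K) * fromℕ (F n (suc K)) + S) * (recip (suc n) * invFact n)
        ≡⟨ solve 4 (λ x s u f → (x :+ s) :* (u :* f) := u :* (x :* f :+ s :* f)) refl
                   (fromℕ (suc K) * fromℕ (F n (suc K))) S (recip (suc n)) (invFact n) ⟩
      recip (suc n) * ((fromℕ (suc K) * fromℕ (F n (suc K))) * invFact n + S * invFact n)
        ≡⟨ cong (recip (suc n) *_) (cong₂ _+_ first rest) ⟩
      recip (suc n) * (fromℕ (suc K) * ((𝕋 ^^ suc K) n * invFact (suc K)) + sumTo n (λ r → fromℕ (r C K) * ((𝕋 ^^ r) n * invFact r)))
        ≡⟨ cong (recip (suc n) *_) (D-^^-ode 𝕋 egf-trees-0 n (λ i i≤n → ode-at i (ih i i≤n)) K) ⟨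
      recip (suc n) * ((fromℕ (suc n) * (𝕋 ^^ suc K) (suc n)) * invFact (suc K))
        ≡⟨ solve 4 (λ u c x f → u :* ((c :* x) :* f) := (u :* c) :* (x :* f)) refl
                   (recip (suc n)) (fromℕ (suc n)) ((𝕋 ^^ suc K) (suc n)) (invFact (suc K)) ⟩
      (recip (suc n) * fromℕ (suc n)) * ((𝕋 ^^ suc K) (suc n) * invFact (suc K))
        ≡⟨ cong (_* ((𝕋 ^^ suc K) (suc n) * invFact (suc K))) (trans (ℚ.*-comm (recip (suc n)) _) (fromℕ*recip≡1 (suc n))) ⟩
      1ℚ * ((𝕋 ^^ suc K) (suc n) * invFact (suc K))
        ≡⟨ ℚ.*-identityˡ _ ⟩
      (𝕋 ^^ suc K) (suc n) * invFact (suc K) ∎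
      where
      S = sumTo n (λ r → fromℕ (r C K) * fromℕ (F n r))
      first : (fromℕ (suc K) * fromℕ (F n (suc K))) * invFact n ≡ fromℕ (suc K) * ((𝕋 ^^ suc K) n * invFact (suc K))
      first = trans (ℚ.*-assoc (fromℕ (suc K)) _ (invFact n)) (cong (fromℕ (suc K) *_) (ih n ℕ.≤-refl (suc K)))
      rest : S * invFact n ≡ sumTo n (λ r → fromℕ (r C K) * ((𝕋 ^^ r) n * invFact r))
      rest = trans (sumTo-*ʳ n (invFact n) _)
                   (sumTo-cong n (λ r _ → trans (ℚ.*-assoc (fromℕ (r C K)) (fromℕ (F n r)) (invFact n))
                                                (cong (fromℕ (r C K) *_) (ih n ℕ.≤-refl r))))

    exponentialFormula : ∀ n → ExponentialFormulaAt n
    exponentialFormula = <-rec ExponentialFormulaAt step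
      where
      step : ∀ n → (∀ {i} → i < n → ExponentialFormulaAt i) → ExponentialFormulaAt n
      step zero    _  = exponentialFormula-zero
      step (suc n) ih = exponentialFormula-suc n (λ i i≤n → ih (s≤s i≤n))

    egf-ode : (∀ n → D 𝕋 n ≡ (𝕋 ⊕ expS 𝕋) n) × 𝕋 0 ≡ 0ℚ
    egf-ode = (λ n → ode-at n (exponentialFormula n)) , egf-trees-0

module Ancestry {n : ℕ} (p : Parents n) where

  data Ancestor : Fin n → Fin n → Set where
    parent : ∀ {u v} → lookup p v ≡ just u → Ancestor u v
    above  : ∀ {u w v} → Ancestor w v → lookup p w ≡ just u → Ancestor u v

  data ReachesRoot : Fin n → Set where
    root  : ∀ {v} → lookup p v ≡ nothing → ReachesRoot v
    child : ∀ {v w} → lookup p v ≡ just w → ReachesRoot w → ReachesRoot v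

  Acyclic : Set
  Acyclic = ∀ v → ReachesRoot v

  iter-suc : ∀ k v → iter p (suc k) v ≡ (iter p k v >>= lookup p)
  iter-suc k v with iter p k v
  ... | nothing = refl
  ... | just w  = refl

  iter-suc-first : ∀ k v → iter p (suc k) v ≡ (lookup p v >>= iter p k)
  iter-suc-first zero v with lookup p v
  ... | nothing = refl
  ... | just w  = refl
  iter-suc-first (suc k) v = begin
    iter p (suc (suc k)) v                     ≡⟨ iter-suc (suc k) v ⟩
    (iter p (suc k) v >>= lookup p)            ≡⟨ cong (_>>= lookup p) (iter-suc-first k v) ⟩
    ((lookup p v >>= iter p k) >>= lookup p)   ≡⟨ bind-iter (lookup p v) ⟩
    (lookup p v >>= iter p (suc k))            ∎
    where
    bind-iter : ∀ m → ((m >>= iter p k) >>= lookup p) ≡ (m >>= iter p (suc k))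
    bind-iter nothing  = refl
    bind-iter (just w) = sym (iter-suc k w)

  iter-nothing-mono : ∀ {k k′ v} → k ≤ k′ → iter p k v ≡ nothing → iter p k′ v ≡ nothing
  iter-nothing-mono {k′ = zero} z≤n e = e
  iter-nothing-mono {k} {suc k′} {v} k≤1+k′ e with ℕ.m≤n⇒m<n∨m≡n k≤1+k′
  ... | inj₂ refl       = e
  ... | inj₁ (s≤s k≤k′) = trans (iter-suc k′ v) (cong (_>>= lookup p) (iter-nothing-mono k≤k′ e))

  ancestor⇒iter : ∀ {u v} → Ancestor u v → ∃[ k ] iter p (suc k) v ≡ just u
  ancestor⇒iter (parent e) = 0 , e
  ancestor⇒iter {v = v} (above a e) with ancestor⇒iter a
  ... | k , e′ = suc k , trans (iter-suc (suc k) v) (trans (cong (_>>= lookup p) e′) e)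

  iter⇒ancestor : ∀ k {u v} → iter p (suc k) v ≡ just u → Ancestor u v
  iter⇒ancestor zero e = parent e
  iter⇒ancestor (suc k) {u} {v} e with iter p (suc k) v in e′
  ... | just w = above (iter⇒ancestor k e′) e

  reachesRoot⇒iter : ∀ {v} → ReachesRoot v → ∃[ k ] iter p k v ≡ nothing
  reachesRoot⇒iter {v} (root e) = 1 , trans (iter-suc-first 0 v) (cong (_>>= iter p 0) e)
  reachesRoot⇒iter {v} (child e r) with reachesRoot⇒iter r
  ... | k , e′ = suc k , trans (iter-suc-first k v) (trans (cong (_>>= iter p k) e) e′)

  iter⇒reachesRoot : ∀ k {v} → iter p k v ≡ nothing → ReachesRoot v
  iter⇒reachesRoot (suc k) {v} e = go (lookup p v) refl (trans (sym (iter-suc-first k v)) e)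
    where
    go : ∀ m → lookup p v ≡ m → (m >>= iter p k) ≡ nothing → ReachesRoot v
    go nothing  e₁ _  = root e₁
    go (just w) e₁ e₂ = child e₁ (iter⇒reachesRoot k e₂)

  ancestor-trans : ∀ {u v w} → Ancestor u v → Ancestor v w → Ancestor u w
  ancestor-trans (parent e)  a = above a e
  ancestor-trans (above a e) b = above (ancestor-trans a b) e

  ancestor⇒hasParent : ∀ {u v} → Ancestor u v → ∃[ w ] lookup p v ≡ just w
  ancestor⇒hasParent (parent e)  = _ , e
  ancestor⇒hasParent (above a _) = ancestor⇒hasParent a

  ancestor-viaParent : ∀ {x v y} → Ancestor x v → lookup p v ≡ just y → y ≡ x ⊎ Ancestor x y
  ancestor-viaParent (parent e) e′ = inj₁ (just-injective (trans (sym e′) e))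
  ancestor-viaParent (above a e) e′ with ancestor-viaParent a e′
  ... | inj₁ refl = inj₂ (parent e)
  ... | inj₂ a′   = inj₂ (above a′ e)

  root-noAncestor : ∀ {u v} → lookup p v ≡ nothing → ¬ Ancestor u v
  root-noAncestor e a with ancestor⇒hasParent a
  ... | _ , e′ with trans (sym e) e′
  ... | ()

  reachesRoot⇒¬selfAncestor : ∀ {x} → ReachesRoot x → ¬ Ancestor x x
  reachesRoot⇒¬selfAncestor (root e) a = root-noAncestor e a
  reachesRoot⇒¬selfAncestor (child e r) a with ancestor-viaParent a e
  ... | inj₁ refl = reachesRoot⇒¬selfAncestor r a
  ... | inj₂ a′   = reachesRoot⇒¬selfAncestor r (ancestor-trans (parent e) a′)

  -- Among the n + 1 vertices iter p 0 v, …, iter p n v two coincide, so the walk from v is eventually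
  -- periodic and never stops.
  module _ {v w} (iter-n≡just : iter p n v ≡ just w) where

    private
      iter≤n-just : ∀ i → i ≤ n → ∃[ x ] iter p i v ≡ just x
      iter≤n-just i i≤n with iter p i v in e
      ... | just x  = x , refl
      ... | nothing with trans (sym iter-n≡just) (iter-nothing-mono i≤n e)
      ... | ()

      position : Fin (suc n) → Fin n
      position i = proj₁ (iter≤n-just (toℕ i) (ℕ.≤-pred (Fin.toℕ<n i)))

      position-spec : ∀ i → iter p (toℕ i) v ≡ just (position i)
      position-spec i = proj₂ (iter≤n-just (toℕ i) (ℕ.≤-pred (Fin.toℕ<n i)))

      collision = Fin.pigeonhole (ℕ.n<1+n n) position
      i₀ = toℕ (proj₁ collision)
      j₀ = toℕ (proj₁ (proj₂ collision))

      i₀<j₀ : i₀ < j₀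
      i₀<j₀ = proj₁ (proj₂ (proj₂ collision))

      j₀≤n : j₀ ≤ n
      j₀≤n = ℕ.≤-pred (Fin.toℕ<n (proj₁ (proj₂ collision)))

      periodic : ∀ s → iter p (s ℕ.+ i₀) v ≡ iter p (s ℕ.+ j₀) v
      periodic zero = trans (position-spec (proj₁ collision))
                           (trans (cong just (proj₂ (proj₂ (proj₂ collision)))) (sym (position-spec (proj₁ (proj₂ collision)))))
      periodic (suc s) = trans (iter-suc (s ℕ.+ i₀) v) (trans (cong (_>>= lookup p) (periodic s)) (sym (iter-suc (s ℕ.+ j₀) v)))

    iter-never-nothing : ∀ m → iter p m v ≢ nothing
    iter-never-nothing = <-rec (λ m → iter p m v ≢ nothing) step
      where
      step : ∀ m → (∀ {k} → k < m → iter p k v ≢ nothing) → iter p m v ≢ nothing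
      step m ih e with m ℕ.≤? j₀
      ... | yes m≤j₀ with trans (sym (proj₂ (iter≤n-just j₀ j₀≤n))) (iter-nothing-mono m≤j₀ e)
      ... | ()
      step m ih e | no m≰j₀ =
        ih (subst (s ℕ.+ i₀ <_) m≡s+j₀ (ℕ.+-monoʳ-< s i₀<j₀)) (trans (periodic s) (trans (cong (λ k → iter p k v) m≡s+j₀) e))
        where
        s = m ∸ j₀
        m≡s+j₀ : s ℕ.+ j₀ ≡ m
        m≡s+j₀ = ℕ.m∸n+n≡m (ℕ.<⇒≤ (ℕ.≰⇒> m≰j₀))

  iter-nothing⇒iter-n : ∀ {k v} → iter p k v ≡ nothing → iter p n v ≡ nothing
  iter-nothing⇒iter-n {k} {v} e with iter p n v in e′
  ... | nothing = refl
  ... | just w  = ⊥-elim (iter-never-nothing e′ k e)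

  reachesRoot⇒iter-n : ∀ {v} → ReachesRoot v → iter p n v ≡ nothing
  reachesRoot⇒iter-n r = iter-nothing⇒iter-n {proj₁ (reachesRoot⇒iter r)} (proj₂ (reachesRoot⇒iter r))

module BooleanLemmas where

  ∧-intro : ∀ {x y} → T x → T y → T (x ∧ y)
  ∧-intro tx ty = Equivalence.from T-∧ (tx , ty)

  ∧-elim : ∀ {x y} → T (x ∧ y) → T x × T y
  ∧-elim = Equivalence.to T-∧

  ¬T⇒T-not : ∀ {b} → ¬ T b → T (not b)
  ¬T⇒T-not {false} _  = _
  ¬T⇒T-not {true}  ¬t = ¬t _

  T-not⇒¬T : ∀ {b} → T (not b) → ¬ T b
  T-not⇒¬T {false} _ ()

  T-⇔⇒≡ : ∀ {x y} → (T x → T y) → (T y → T x) → x ≡ y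
  T-⇔⇒≡ {false} {false} _ _ = refl
  T-⇔⇒≡ {false} {true}  _ g = ⊥-elim (g _)
  T-⇔⇒≡ {true}  {false} f _ = ⊥-elim (f _)
  T-⇔⇒≡ {true}  {true}  _ _ = refl

  T-≟ᵇ⁻ : ∀ {x y} → T (does (x ≟ᵇ y)) → x ≡ y
  T-≟ᵇ⁻ {false} {false} _ = refl
  T-≟ᵇ⁻ {true}  {true}  _ = refl

  T-≟ᵇ⁺ : ∀ {x y} → x ≡ y → T (does (x ≟ᵇ y))
  T-≟ᵇ⁺ {false} refl = _
  T-≟ᵇ⁺ {true}  refl = _

  <ᵇ≡true : ∀ {m n} → m < n → (m <ᵇ n) ≡ true
  <ᵇ≡true m<n = Equivalence.to T-≡ (ℕ.<⇒<ᵇ m<n)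

  <ᵇ≡false : ∀ {m n} → n ≤ m → (m <ᵇ n) ≡ false
  <ᵇ≡false {m} {n} n≤m with m <ᵇ n in e
  ... | false = refl
  ... | true  = ⊥-elim (ℕ.<⇒≱ (ℕ.<ᵇ⇒< m n (subst T (sym e) _)) n≤m)

  T-is-nothing⁻ : ∀ {A : Set} {m : Maybe A} → T (is-nothing m) → m ≡ nothing
  T-is-nothing⁻ {m = nothing} _ = refl

  T-is-nothing⁺ : ∀ {A : Set} {m : Maybe A} → m ≡ nothing → T (is-nothing m)
  T-is-nothing⁺ refl = _


module ForestPredicates where

  open Ancestry
  open BooleanLemmas

  acyclic : ∀ {n} → Parents n → Bool
  acyclic {n} p = all (λ v → is-nothing (iter p n v)) (allFin n)

  acyclic⁻ : ∀ {n} {p : Parents n} → T (acyclic p) → Acyclic p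
  acyclic⁻ {n} {p} h v = iter⇒reachesRoot p n (T-is-nothing⁻ (All.tabulate⁻ (All.all⁺ _ (allFin n) h) v))

  acyclic⁺ : ∀ {n} {p : Parents n} → Acyclic p → T (acyclic p)
  acyclic⁺ {p = p} ac = All.all⁻ _ (All.tabulate⁺ (λ v → T-is-nothing⁺ (reachesRoot⇒iter-n p (ac v))))

  eqMaybeFin⁻ : ∀ {n} (m : Maybe (Fin n)) u → T (eqMaybeFin m u) → m ≡ just u
  eqMaybeFin⁻ (just w) u h with w Fin.≟ u
  ... | yes refl = refl

  eqMaybeFin-refl : ∀ {n} (u : Fin n) → T (eqMaybeFin (just u) u)
  eqMaybeFin-refl u with u Fin.≟ u
  ... | yes _  = _
  ... | no u≢u = u≢u refl

  strictAncestor⁻ : ∀ {n} {p : Parents n} {u v} → T (strictAncestor p u v) → Ancestor p u v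
  strictAncestor⁻ {n} {p} {u} {v} h with Any.applyUpTo⁻ id (Any.any⁻ _ (upTo n) h)
  ... | k , _ , e = iter⇒ancestor p k (eqMaybeFin⁻ (iter p (suc k) v) u e)

  strictAncestor⁺ : ∀ {n} {p : Parents n} {u v} → ReachesRoot p v → Ancestor p u v → T (strictAncestor p u v)
  strictAncestor⁺ {n} {p} {u} {v} r a with ancestor⇒iter p a
  ... | k , e with k ℕ.<? n
  ... | yes k<n = Any.any⁺ _ (Any.applyUpTo⁺ id (subst (λ m → T (eqMaybeFin m u)) (sym e) (eqMaybeFin-refl u)) k<n)
  ... | no k≮n with trans (sym e) (iter-nothing-mono p (ℕ.m≤n⇒m≤1+n (ℕ.≮⇒≥ k≮n)) (reachesRoot⇒iter-n p r))
  ... | ()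

  chain₃⁻ : ∀ {n} {p : Parents n} {u v w} → T (chain p (u ∷ v ∷ w ∷ [])) → Ancestor p u v × Ancestor p v w
  chain₃⁻ {p = p} {u} {v} {w} h with ∧-elim {strictAncestor p u v} h
  ... | uv , h′ = strictAncestor⁻ uv , strictAncestor⁻ (proj₁ (∧-elim {strictAncestor p v w} h′))

  chain₃⁺ : ∀ {n} {p : Parents n} {u v w} → Acyclic p → Ancestor p u v → Ancestor p v w → T (chain p (u ∷ v ∷ w ∷ []))
  chain₃⁺ ac uv vw = ∧-intro (strictAncestor⁺ (ac _) uv) (∧-intro (strictAncestor⁺ (ac _) vw) _)

module PatternAvoidance where

  open Ancestry
  open BooleanLemmas
  open ForestPredicates

  TopMinimal : ∀ {n} → Parents n → Set
  TopMinimal p = ∀ {u v w} → Ancestor p u v → Ancestor p v w → toℕ u < toℕ v × toℕ u < toℕ w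

  seqs-Any⁻ : ∀ {n} {P : List (Fin n) → Set} k → Any P (seqs n (suc k)) → ∃[ u ] Any (P ∘ (u ∷_)) (seqs n k)
  seqs-Any⁻ {n} k h with Any.tabulate⁻ (Any.concatMap⁻ (λ v → map (v ∷_) (seqs n k)) h)
  ... | u , h′ = u , Any.map⁻ h′

  seqs-Any⁺ : ∀ {n} {P : List (Fin n) → Set} k u → Any (P ∘ (u ∷_)) (seqs n k) → Any P (seqs n (suc k))
  seqs-Any⁺ {n} k u h = Any.concatMap⁺ (λ v → map (v ∷_) (seqs n k)) (Any.tabulate⁺ u (Any.map⁺ h))

  isOccurrence : ∀ {n} → Parents n → Pattern → List (Fin n) → Bool
  isOccurrence p π vs = chain p vs ∧ sameOrder π vs

  contains₃⁻ : ∀ {n} {p : Parents n} {a b c} → T (contains p (a ∷ b ∷ c ∷ [])) →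
               ∃[ u ] ∃[ v ] ∃[ w ] T (isOccurrence p (a ∷ b ∷ c ∷ []) (u ∷ v ∷ w ∷ []))
  contains₃⁻ {n} h with seqs-Any⁻ 2 (Any.any⁻ _ (seqs n 3) h)
  ... | u , h₁ with seqs-Any⁻ 1 h₁
  ... | v , h₂ with seqs-Any⁻ 0 h₂
  ... | w , here h₃ = u , v , w , h₃

  contains₃⁺ : ∀ {n} {p : Parents n} {a b c} u v w →
               T (isOccurrence p (a ∷ b ∷ c ∷ []) (u ∷ v ∷ w ∷ [])) → T (contains p (a ∷ b ∷ c ∷ []))
  contains₃⁺ u v w h = Any.any⁺ _ (seqs-Any⁺ 2 u (seqs-Any⁺ 1 v (seqs-Any⁺ 0 w (here h))))

  data SameCmp (a b x y : ℕ) : Set where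
    both< : T (a <ᵇ b) → x < y → SameCmp a b x y
    both> : T (b <ᵇ a) → y < x → SameCmp a b x y

  SameCmp-sym : ∀ {a b x y} → SameCmp a b x y → SameCmp b a y x
  SameCmp-sym (both< ab x<y) = both> ab x<y
  SameCmp-sym (both> ba y<x) = both< ba y<x

  SameCmp⇒<ᵇ≡ : ∀ {a b x y} → SameCmp a b x y → (a <ᵇ b) ≡ (x <ᵇ y)
  SameCmp⇒<ᵇ≡ (both< ab x<y) = trans (Equivalence.to T-≡ ab) (sym (<ᵇ≡true x<y))
  SameCmp⇒<ᵇ≡ {a} {b} (both> ba y<x) =
    trans (<ᵇ≡false (ℕ.<⇒≤ (ℕ.<ᵇ⇒< b a ba))) (sym (<ᵇ≡false (ℕ.<⇒≤ y<x)))

  <ᵇ-irrefl≡ : ∀ a x → (a <ᵇ a) ≡ (x <ᵇ x)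
  <ᵇ-irrefl≡ a x = trans (<ᵇ≡false (ℕ.≤-refl {a})) (sym (<ᵇ≡false (ℕ.≤-refl {x})))

  sameOrder₃⁺ : ∀ {n} {a b c} {u v w : Fin n} → SameCmp a b (toℕ u) (toℕ v) → SameCmp a c (toℕ u) (toℕ w) →
                SameCmp b c (toℕ v) (toℕ w) → T (sameOrder (a ∷ b ∷ c ∷ []) (u ∷ v ∷ w ∷ []))
  sameOrder₃⁺ {a = a} {b} {c} {u} {v} {w} ab ac bc =
    ∧-intro (agree (<ᵇ-irrefl≡ a (toℕ u))) (∧-intro (agree (SameCmp⇒<ᵇ≡ ab)) (∧-intro (agree (SameCmp⇒<ᵇ≡ ac))
    (∧-intro (agree (SameCmp⇒<ᵇ≡ (SameCmp-sym ab))) (∧-intro (agree (<ᵇ-irrefl≡ b (toℕ v))) (∧-intro (agree (SameCmp⇒<ᵇ≡ bc))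
    (∧-intro (agree (SameCmp⇒<ᵇ≡ (SameCmp-sym ac))) (∧-intro (agree (SameCmp⇒<ᵇ≡ (SameCmp-sym bc)))
    (∧-intro (agree (<ᵇ-irrefl≡ c (toℕ w))) _))))))))
    where
    agree = T-≟ᵇ⁺

  sameOrder₃⁻ : ∀ {n} {a b c} {u v w : Fin n} → T (sameOrder (a ∷ b ∷ c ∷ []) (u ∷ v ∷ w ∷ [])) →
                (a <ᵇ b) ≡ (toℕ u <ᵇ toℕ v) × (a <ᵇ c) ≡ (toℕ u <ᵇ toℕ w)
  sameOrder₃⁻ {a = a} {b} {c} {u} {v} {w} h with ∧-elim {does ((a <ᵇ a) ≟ᵇ (toℕ u <ᵇ toℕ u))} h
  ... | _ , h₁ with ∧-elim {does ((a <ᵇ b) ≟ᵇ (toℕ u <ᵇ toℕ v))} h₁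
  ... | ab , h₂ = T-≟ᵇ⁻ ab , T-≟ᵇ⁻ (proj₁ (∧-elim {does ((a <ᵇ c) ≟ᵇ (toℕ u <ᵇ toℕ w))} h₂))

  topMinimal⇒¬contains : ∀ {n} {p : Parents n} → TopMinimal p → ∀ {a b c} → (a <ᵇ b) ≡ false ⊎ (a <ᵇ c) ≡ false →
                         T (not (contains p (a ∷ b ∷ c ∷ [])))
  topMinimal⇒¬contains {p = p} top {a} {b} {c} first-not-min = ¬T⇒T-not (λ h → refute first-not-min (contains₃⁻ h))
    where
    refute : (a <ᵇ b) ≡ false ⊎ (a <ᵇ c) ≡ false →
             ∃[ u ] ∃[ v ] ∃[ w ] T (isOccurrence p (a ∷ b ∷ c ∷ []) (u ∷ v ∷ w ∷ [])) → ⊥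
    refute ab∨ac (u , v , w , occ) with ∧-elim {chain p (u ∷ v ∷ w ∷ [])} occ
    ... | ch , so with chain₃⁻ ch | sameOrder₃⁻ {a = a} {b} {c} {u} {v} {w} so
    ... | uv , vw | ab , ac with top uv vw | ab∨ac
    ... | u<v , _ | inj₁ ab≡false = subst T ab≡false (subst T (sym ab) (ℕ.<⇒<ᵇ u<v))
    ... | _ , u<w | inj₂ ac≡false = subst T ac≡false (subst T (sym ac) (ℕ.<⇒<ᵇ u<w))

  topMinimal⇒avoids : ∀ {n} {p : Parents n} → TopMinimal p → T (avoids p S₀)
  topMinimal⇒avoids {p = p} top = All.all⁻ (λ π → not (contains p π)) {xs = S₀}
    (topMinimal⇒¬contains top (inj₁ refl) ∷ topMinimal⇒¬contains top (inj₂ refl) ∷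
    topMinimal⇒¬contains top (inj₁ refl) ∷ topMinimal⇒¬contains top (inj₁ refl) ∷ [])

  -- Three distinct labels with the first not the smallest are in the relative order of a pattern of S₀.
  avoids⇒topMinimal : ∀ {n} {p : Parents n} → Acyclic p → T (avoids p S₀) → TopMinimal p
  avoids⇒topMinimal {p = p} acyc h {u} {v} {w} uv vw = classify (All.all⁺ _ S₀ h) (ℕ.<-cmp x y) (ℕ.<-cmp x z) (ℕ.<-cmp y z)
    where
    x = toℕ u
    y = toℕ v
    z = toℕ w
    occurs : ∀ {a b c} → SameCmp a b x y → SameCmp a c x z → SameCmp b c y z → T (contains p (a ∷ b ∷ c ∷ []))
    occurs ab ac bc = contains₃⁺ u v w (∧-intro (chain₃⁺ acyc uv vw) (sameOrder₃⁺ ab ac bc))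
    distinct : ∀ {s t} → Ancestor p s t → toℕ s ≢ toℕ t
    distinct a e = reachesRoot⇒¬selfAncestor p (acyc _) (subst (Ancestor p _) (sym (Fin.toℕ-injective e)) a)
    classify : All (λ π → T (not (contains p π))) S₀ → Tri (x < y) (x ≡ y) (y < x) → Tri (x < z) (x ≡ z) (z < x) →
               Tri (y < z) (y ≡ z) (z < y) → x < y × x < z
    classify _ (tri≈ _ x≡y _) _ _ = ⊥-elim (distinct uv x≡y)
    classify _ _ (tri≈ _ x≡z _) _ = ⊥-elim (distinct (ancestor-trans p uv vw) x≡z)
    classify _ _ _ (tri≈ _ y≡z _) = ⊥-elim (distinct vw y≡z)
    classify _ (tri< x<y _ _) (tri< x<z _ _) _ = x<y , x<z
    classify (_ ∷ ¬231 ∷ _) (tri< x<y _ _) (tri> _ _ z<x) _ =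
      ⊥-elim (T-not⇒¬T ¬231 (occurs (both< _ x<y) (both> _ z<x) (both> _ (ℕ.<-trans z<x x<y))))
    classify (¬213 ∷ _) (tri> _ _ y<x) (tri< x<z _ _) _ =
      ⊥-elim (T-not⇒¬T ¬213 (occurs (both> _ y<x) (both< _ x<z) (both< _ (ℕ.<-trans y<x x<z))))
    classify (_ ∷ _ ∷ ¬312 ∷ _) (tri> _ _ y<x) (tri> _ _ z<x) (tri< y<z _ _) =
      ⊥-elim (T-not⇒¬T ¬312 (occurs (both> _ y<x) (both> _ z<x) (both< _ y<z)))
    classify (_ ∷ _ ∷ _ ∷ ¬321 ∷ _) (tri> _ _ y<x) (tri> _ _ z<x) (tri> _ _ z<y) =
      ⊥-elim (T-not⇒¬T ¬321 (occurs (both> _ y<x) (both> _ z<x) (both> _ z<y)))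

  good : ∀ {n} → Parents n → Bool
  good p = acyclic p ∧ avoids p S₀

  good⁻ : ∀ {n} {p : Parents n} → T (good p) → Acyclic p × TopMinimal p
  good⁻ {p = p} h with ∧-elim {acyclic p} h
  ... | acyc , avoid = acyclic⁻ acyc , avoids⇒topMinimal (acyclic⁻ acyc) avoid

  good⁺ : ∀ {n} {p : Parents n} → Acyclic p → TopMinimal p → T (good p)
  good⁺ acyc top = ∧-intro (acyclic⁺ acyc) (topMinimal⇒avoids top)

-- A forest on [n + 1] is x ∷ tl, where x is the parent of the vertex 0 of smallest label and tl, read
-- through i ↦ i + 1, is a forest q on [n] some of whose roots have been attached to 0.
module VertexZero where

  open Ancestry
  open BooleanLemmas
  open PatternAvoidance

  data LiftEntry {n : ℕ} : Maybe (Fin n) → Maybe (Fin (suc n)) → Set where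
    stay   : LiftEntry nothing nothing
    attach : LiftEntry nothing (just zero)
    shift  : ∀ {w} → LiftEntry (just w) (just (suc w))

  Lifting : ∀ {n m} → Vec (Maybe (Fin n)) m → Vec (Maybe (Fin (suc n))) m → Set
  Lifting q tl = ∀ v → LiftEntry (lookup q v) (lookup tl v)

  ZeroChildless : ∀ {n m} → Vec (Maybe (Fin (suc n))) m → Set
  ZeroChildless tl = ∀ v → lookup tl v ≢ just zero

  zeroChildless : ∀ {n m} → Vec (Maybe (Fin (suc n))) m → Bool
  zeroChildless []                  = true
  zeroChildless (nothing ∷ tl)      = zeroChildless tl
  zeroChildless (just zero ∷ tl)    = false
  zeroChildless (just (suc _) ∷ tl) = zeroChildless tl

  zeroChildless⁻ : ∀ {n m} (tl : Vec (Maybe (Fin (suc n))) m) → T (zeroChildless tl) → ZeroChildless tl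
  zeroChildless⁻ (nothing ∷ tl)      h zero    ()
  zeroChildless⁻ (just (suc _) ∷ tl) h zero    ()
  zeroChildless⁻ (nothing ∷ tl)      h (suc v) = zeroChildless⁻ tl h v
  zeroChildless⁻ (just (suc _) ∷ tl) h (suc v) = zeroChildless⁻ tl h v

  zeroChildless⁺ : ∀ {n m} (tl : Vec (Maybe (Fin (suc n))) m) → ZeroChildless tl → T (zeroChildless tl)
  zeroChildless⁺ []                  h = _
  zeroChildless⁺ (nothing ∷ tl)      h = zeroChildless⁺ tl (h ∘ suc)
  zeroChildless⁺ (just zero ∷ tl)    h = h zero refl
  zeroChildless⁺ (just (suc _) ∷ tl) h = zeroChildless⁺ tl (h ∘ suc)

  module _ {n} {a : Maybe (Fin n)} {b : Maybe (Fin (suc n))} where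

    lift-just : ∀ {w} → LiftEntry a b → a ≡ just w → b ≡ just (suc w)
    lift-just shift refl = refl

    lift-nothing : LiftEntry a b → a ≡ nothing → b ≡ nothing ⊎ b ≡ just zero
    lift-nothing stay   _ = inj₁ refl
    lift-nothing attach _ = inj₂ refl

    unlift-suc : ∀ {w} → LiftEntry a b → b ≡ just (suc w) → a ≡ just w
    unlift-suc shift refl = refl

    unlift-zero : LiftEntry a b → b ≡ just zero → a ≡ nothing
    unlift-zero attach _ = refl

    unlift-nothing : LiftEntry a b → b ≡ nothing → a ≡ nothing
    unlift-nothing stay _ = refl

  module _ {n} (q : Parents n) (x : Maybe (Fin (suc n))) (tl : Vec (Maybe (Fin (suc n))) n) (L : Lifting q tl) where

    private
      p : Parents (suc n)
      p = x ∷ tl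

    ancestor-lift : ∀ {u v} → Ancestor q u v → Ancestor p (suc u) (suc v)
    ancestor-lift {v = v} (parent e)           = parent (lift-just (L v) e)
    ancestor-lift         (above {w = w} a e)  = above (ancestor-lift a) (lift-just (L w) e)

    ancestor-unlift : (∀ {y z} → Ancestor p zero y → Ancestor p z zero → ⊥) → ∀ {u v} → Ancestor p (suc u) (suc v) → Ancestor q u v
    ancestor-unlift no-chain a = go a refl refl
      where
      go : ∀ {s t} → Ancestor p s t → ∀ {u v} → s ≡ suc u → t ≡ suc v → Ancestor q u v
      go (parent e) {v = v} refl refl               = parent (unlift-suc (L v) e)
      go (above {w = zero} a e) refl refl           = ⊥-elim (no-chain a (parent e))
      go (above {w = suc w} a e) refl refl          = above (go a refl refl) (unlift-suc (L w) e)

    reachesRoot-unlift : ∀ {v} → ReachesRoot p (suc v) → ReachesRoot q v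
    reachesRoot-unlift r = go r refl
      where
      go : ∀ {s} → ReachesRoot p s → ∀ {v} → s ≡ suc v → ReachesRoot q v
      go (root e) {v} refl                    = root (unlift-nothing (L v) e)
      go (child {w = zero} e r) {v} refl      = root (unlift-zero (L v) e)
      go (child {w = suc w} e r) {v} refl     = child (unlift-suc (L v) e) (go r refl)

    reachesRoot-lift : ReachesRoot p zero → ∀ {v} → ReachesRoot q v → ReachesRoot p (suc v)
    reachesRoot-lift r₀ {v} (root e) with lift-nothing (L v) e
    ... | inj₁ e′ = root e′
    ... | inj₂ e′ = child e′ r₀
    reachesRoot-lift r₀ {v} (child e r) = child (lift-just (L v) e) (reachesRoot-lift r₀ r)

    acyclic-unlift : Acyclic p → Acyclic q
    acyclic-unlift acyc v = reachesRoot-unlift (acyc (suc v))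

    topMinimal-unlift : TopMinimal p → TopMinimal q
    topMinimal-unlift top uv vw with top (ancestor-lift uv) (ancestor-lift vw)
    ... | s≤s u<v , s≤s u<w = u<v , u<w

    topMinimal-lift : TopMinimal q → (∀ {y z} → Ancestor p zero y → Ancestor p z zero → ⊥) →
                      ∀ {u v w} → Ancestor p (suc u) (suc v) → Ancestor p (suc v) (suc w) →
                      suc (toℕ u) < suc (toℕ v) × suc (toℕ u) < suc (toℕ w)
    topMinimal-lift top no-chain uv vw with top (ancestor-unlift no-chain uv) (ancestor-unlift no-chain vw)
    ... | u<v , u<w = s≤s u<v , s≤s u<w

    zeroChildless⇒leaf : ZeroChildless tl → x ≢ just zero → ∀ {y} → ¬ Ancestor p zero y
    zeroChildless⇒leaf childless x≢0 a = go a refl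
      where
      go : ∀ {s t} → Ancestor p s t → s ≡ zero → ⊥
      go (parent {v = zero} e) refl          = x≢0 e
      go (parent {v = suc v} e) refl         = childless v e
      go (above {w = zero} a e) refl         = x≢0 e
      go (above {w = suc w} a e) refl        = childless w e

  root-good⁺ : ∀ {n} (q : Parents n) tl → Lifting q tl → Acyclic q → TopMinimal q →
               Acyclic (nothing ∷ tl) × TopMinimal (nothing ∷ tl)
  root-good⁺ q tl L acyc top = acyc′ , top′
    where
    P = nothing ∷ tl
    acyc′ : Acyclic P
    acyc′ zero    = root refl
    acyc′ (suc v) = reachesRoot-lift q nothing tl L (root refl) (acyc v)
    top′ : TopMinimal P
    top′ {v = zero} uv _                         = ⊥-elim (root-noAncestor P refl uv)
    top′ {v = suc v} {zero} _ vw                 = ⊥-elim (root-noAncestor P refl vw)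
    top′ {zero} {suc v} {suc w} _ _              = s≤s z≤n , s≤s z≤n
    top′ {suc u} {suc v} {suc w} uv vw           = topMinimal-lift q nothing tl L top (λ _ a → root-noAncestor P refl a) uv vw

  good-root : ∀ {n} (q : Parents n) tl → Lifting q tl → good (nothing ∷ tl) ≡ good q
  good-root q tl L = T-⇔⇒≡
    (λ h → let acyc , top = good⁻ h in
           good⁺ (acyclic-unlift q nothing tl L acyc) (topMinimal-unlift q nothing tl L top))
    (λ h → let acyc , top = good⁻ h in
           let acyc′ , top′ = root-good⁺ q tl L acyc top in good⁺ acyc′ top′)

  leaf-good⁻ : ∀ {n} (q : Parents n) w₀ tl → Lifting q tl → TopMinimal (just (suc w₀) ∷ tl) →
               lookup q w₀ ≡ nothing × ZeroChildless tl
  leaf-good⁻ q w₀ tl L top = w₀-root , childless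
    where
    w₀-root : lookup q w₀ ≡ nothing
    w₀-root with lookup q w₀ in e
    ... | nothing = refl
    ... | just u with top (parent (lift-just (L w₀) e)) (parent {u = suc w₀} {v = zero} refl)
    ... | _ , ()
    childless : ZeroChildless tl
    childless v e with top (parent {u = suc w₀} {v = zero} refl) (parent {v = suc v} e)
    ... | () , _

  leaf-good⁺ : ∀ {n} (q : Parents n) w₀ tl → Lifting q tl → Acyclic q → TopMinimal q →
               lookup q w₀ ≡ nothing → ZeroChildless tl → Acyclic (just (suc w₀) ∷ tl) × TopMinimal (just (suc w₀) ∷ tl)
  leaf-good⁺ q w₀ tl L acyc top w₀-root childless = acyc′ , top′
    where
    P = just (suc w₀) ∷ tl
    tl-w₀ : lookup tl w₀ ≡ nothing
    tl-w₀ with lift-nothing (L w₀) w₀-root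
    ... | inj₁ e = e
    ... | inj₂ e = ⊥-elim (childless w₀ e)
    acyc′ : Acyclic P
    acyc′ zero    = child refl (root tl-w₀)
    acyc′ (suc v) = reachesRoot-lift q _ tl L (acyc′ zero) (acyc v)
    leaf : ∀ {y} → ¬ Ancestor P zero y
    leaf = zeroChildless⇒leaf q _ tl L childless (λ ())
    -- the only strict ancestor of 0 is the root suc w₀, which has none itself
    nothing-above-0 : ∀ {a v} → Ancestor P a (suc v) → ¬ Ancestor P (suc v) zero
    nothing-above-0 a₁ a₂ with ancestor-viaParent P a₂ refl
    ... | inj₁ refl = root-noAncestor P tl-w₀ a₁
    ... | inj₂ a₃   = root-noAncestor P tl-w₀ a₃
    top′ : TopMinimal P
    top′ {v = zero} _ vw                = ⊥-elim (leaf vw)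
    top′ {v = suc v} {zero} uv vw       = ⊥-elim (nothing-above-0 uv vw)
    top′ {zero} {suc v} {suc w} uv _    = ⊥-elim (leaf uv)
    top′ {suc u} {suc v} {suc w} uv vw  = topMinimal-lift q _ tl L top (λ a _ → leaf a) uv vw

  good-leaf : ∀ {n} (q : Parents n) w₀ tl → Lifting q tl →
              good (just (suc w₀) ∷ tl) ≡ good q ∧ (is-nothing (lookup q w₀) ∧ zeroChildless tl)
  good-leaf q w₀ tl L = T-⇔⇒≡
    (λ h → let acyc , top = good⁻ h in
           let w₀-root , childless = leaf-good⁻ q w₀ tl L top in
           ∧-intro (good⁺ (acyclic-unlift q _ tl L acyc) (topMinimal-unlift q _ tl L top))
                   (∧-intro (T-is-nothing⁺ w₀-root) (zeroChildless⁺ tl childless)))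
    (λ h → let g , h′ = ∧-elim {good q} h in
           let w₀-root , childless = ∧-elim {is-nothing (lookup q w₀)} h′ in
           let acyc , top = good⁻ g in
           let acyc′ , top′ = leaf-good⁺ q w₀ tl L acyc top (T-is-nothing⁻ w₀-root) (zeroChildless⁻ tl childless) in
           good⁺ acyc′ top′)

  good-loop : ∀ {n} (tl : Vec (Maybe (Fin (suc n))) n) → good (just zero ∷ tl) ≡ false
  good-loop tl = T-⇔⇒≡ (λ h → never (proj₁ (good⁻ h) zero) refl) (λ ())
    where
    never : ∀ {s} → ReachesRoot (just zero ∷ tl) s → s ≡ zero → ⊥
    never (root ())     refl
    never (child refl r) refl = never r refl

module ForestCounting where

  open import Data.Nat using (_+_; _*_)
  open import Data.Nat.Combinatorics using (_C_; nCk+nC[k+1]≡[n+1]C[k+1]; k>n⇒nCk≡0)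
  open import Data.Nat.Solver using (module +-*-Solver)
  open +-*-Solver
  open NaturalSums
  open VertexZero
  open PatternAvoidance using (good)
  open ForestPredicates using (acyclic)

  liftings : ∀ {n m} → Vec (Maybe (Fin n)) m → List (Vec (Maybe (Fin (suc n))) m)
  liftings []            = [] ∷ []
  liftings (nothing ∷ q) = concatMap (λ tl → (nothing ∷ tl) ∷ (just zero ∷ tl) ∷ []) (liftings q)
  liftings (just w ∷ q)  = map (just (suc w) ∷_) (liftings q)

  nothings : ∀ {A : Set} {m} → Vec (Maybe A) m → ℕ
  nothings []            = 0
  nothings (nothing ∷ v) = suc (nothings v)
  nothings (just _ ∷ v)  = nothings v

  module _ {n m} (q : Vec (Maybe (Fin n)) m) (G : Vec (Maybe (Fin (suc n))) (suc m) → ℕ) where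

    sum-liftings-nothing : sumOver (liftings (nothing ∷ q)) G ≡ sumOver (liftings q) (G ∘ (nothing ∷_)) + sumOver (liftings q) (G ∘ (just zero ∷_))
    sum-liftings-nothing = begin
      sumOver (liftings (nothing ∷ q)) G
        ≡⟨ sumOver-concatMap _ (liftings q) G ⟩
      sumOver (liftings q) (λ tl → G (nothing ∷ tl) + (G (just zero ∷ tl) + 0))
        ≡⟨ sumOver-cong (liftings q) (λ tl → cong (G (nothing ∷ tl) +_) (ℕ.+-identityʳ _)) ⟩
      sumOver (liftings q) (λ tl → G (nothing ∷ tl) + G (just zero ∷ tl))
        ≡⟨ sumOver-+ (liftings q) _ _ ⟩
      sumOver (liftings q) (G ∘ (nothing ∷_)) + sumOver (liftings q) (G ∘ (just zero ∷_)) ∎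

    sum-liftings-just : ∀ w → sumOver (liftings (just w ∷ q)) G ≡ sumOver (liftings q) (G ∘ (just (suc w) ∷_))
    sum-liftings-just w = sumOver-map _ (liftings q) G

  sum-liftings-cong : ∀ {n m} (q : Vec (Maybe (Fin n)) m) {f g : Vec (Maybe (Fin (suc n))) m → ℕ} →
                      (∀ tl → Lifting q tl → f tl ≡ g tl) → sumOver (liftings q) f ≡ sumOver (liftings q) g
  sum-liftings-cong [] f≗g = cong (_+ 0) (f≗g [] (λ ()))
  sum-liftings-cong (nothing ∷ q) {f} {g} f≗g = begin
    sumOver (liftings (nothing ∷ q)) f
      ≡⟨ sum-liftings-nothing q f ⟩
    sumOver (liftings q) (f ∘ (nothing ∷_)) + sumOver (liftings q) (f ∘ (just zero ∷_))
      ≡⟨ cong₂ _+_ (sum-liftings-cong q (λ tl L → f≗g _ (lifting-∷ stay L))) (sum-liftings-cong q (λ tl L → f≗g _ (lifting-∷ attach L))) ⟩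
    sumOver (liftings q) (g ∘ (nothing ∷_)) + sumOver (liftings q) (g ∘ (just zero ∷_))
      ≡⟨ sum-liftings-nothing q g ⟨
    sumOver (liftings (nothing ∷ q)) g ∎
    where
    lifting-∷ : ∀ {b tl} → LiftEntry nothing b → Lifting q tl → Lifting (nothing ∷ q) (b ∷ tl)
    lifting-∷ e L zero    = e
    lifting-∷ e L (suc v) = L v
  sum-liftings-cong (just w ∷ q) {f} {g} f≗g =
    trans (sum-liftings-just q f w) (trans (sum-liftings-cong q (λ tl L → f≗g _ (lifting-∷ L))) (sym (sum-liftings-just q g w)))
    where
    lifting-∷ : ∀ {tl} → Lifting q tl → Lifting (just w ∷ q) (just (suc w) ∷ tl)
    lifting-∷ L zero    = shift
    lifting-∷ L (suc v) = L v

  entries : ∀ n → List (Maybe (Fin n))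
  entries n = nothing ∷ map just (allFin n)

  sum-allParents-suc : ∀ n m (G : Vec (Maybe (Fin n)) (suc m) → ℕ) →
    sumOver (allParents n (suc m)) G ≡ sumOver (entries n) (λ x → sumOver (allParents n m) (G ∘ (x ∷_)))
  sum-allParents-suc n m G = trans (sumOver-concatMap (λ x → map (x ∷_) (allParents n m)) (entries n) G)
                                   (sumOver-cong (entries n) (λ x → sumOver-map (x ∷_) (allParents n m) G))

  sum-entries : ∀ n (f : Maybe (Fin n) → ℕ) → sumOver (entries n) f ≡ f nothing + sumOver (allFin n) (f ∘ just)
  sum-entries n f = cong (f nothing +_) (sumOver-map just (allFin n) f)

  sum-entries-suc : ∀ n (f : Maybe (Fin (suc n)) → ℕ) →
    sumOver (entries (suc n)) f ≡ (f nothing + f (just zero)) + sumOver (allFin n) (f ∘ just ∘ suc)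
  sum-entries-suc n f = trans (sum-entries (suc n) f)
    (trans (cong (λ z → f nothing + (f (just zero) + z)) (sumOver-tabulate n suc (f ∘ just))) (sym (ℕ.+-assoc (f nothing) _ _)))

  -- Every vector over Maybe (Fin (suc n)) arises from exactly one vector over Maybe (Fin n) by exactly one lifting.
  sum-allParents-liftings : ∀ n m (G : Vec (Maybe (Fin (suc n))) m → ℕ) →
    sumOver (allParents (suc n) m) G ≡ sumOver (allParents n m) (λ q → sumOver (liftings q) G)
  sum-allParents-liftings n zero    G = sym (ℕ.+-identityʳ (G [] + 0))
  sum-allParents-liftings n (suc m) G = begin
    sumOver (allParents (suc n) (suc m)) G
      ≡⟨ sum-allParents-suc (suc n) m G ⟩
    sumOver (entries (suc n)) (λ x → sumOver (allParents (suc n) m) (G ∘ (x ∷_)))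
      ≡⟨ sumOver-cong (entries (suc n)) (λ x → sum-allParents-liftings n m (G ∘ (x ∷_))) ⟩
    sumOver (entries (suc n)) S
      ≡⟨ sum-entries-suc n S ⟩
    (S nothing + S (just zero)) + sumOver (allFin n) (S ∘ just ∘ suc)
      ≡⟨ cong₂ _+_ (sym (sumOver-+ (allParents n m) _ _)) (sumOver-swap (allFin n) (allParents n m) _) ⟩
    sumOver (allParents n m) (λ q → sumOver (liftings q) (G ∘ (nothing ∷_)) + sumOver (liftings q) (G ∘ (just zero ∷_)))
      + sumOver (allParents n m) (λ q → sumOver (allFin n) (λ i → sumOver (liftings q) (G ∘ (just (suc i) ∷_))))
      ≡⟨ cong₂ _+_ (sumOver-cong (allParents n m) (λ q → sym (sum-liftings-nothing q G)))
                   (sumOver-cong (allParents n m) (λ q → sumOver-cong (allFin n) (λ i → sym (sum-liftings-just q G i)))) ⟩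
    sumOver (allParents n m) (λ q → sumOver (liftings (nothing ∷ q)) G)
      + sumOver (allParents n m) (λ q → sumOver (allFin n) (λ i → sumOver (liftings (just i ∷ q)) G))
      ≡⟨ cong (sumOver (allParents n m) (λ q → sumOver (liftings (nothing ∷ q)) G) +_) (sumOver-swap (allParents n m) (allFin n) _) ⟩
    L nothing + sumOver (allFin n) (L ∘ just)
      ≡⟨ sum-entries n L ⟨
    sumOver (entries n) L
      ≡⟨ sum-allParents-suc n m (λ q → sumOver (liftings q) G) ⟨
    sumOver (allParents n (suc m)) (λ q → sumOver (liftings q) G) ∎
    where
    S : Maybe (Fin (suc n)) → ℕ
    S x = sumOver (allParents n m) (λ q → sumOver (liftings q) (G ∘ (x ∷_)))
    L : Maybe (Fin n) → ℕ
    L x = sumOver (allParents n m) (λ q → sumOver (liftings (x ∷ q)) G)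

  sum-is-nothing : ∀ {A : Set} {m} (vec : Vec (Maybe A) m) c → sumOver (allFin m) (λ v → ind (is-nothing (lookup vec v)) c) ≡ nothings vec * c
  sum-is-nothing []                       c = refl
  sum-is-nothing {m = suc m} (nothing ∷ vec) c =
    cong (c +_) (trans (sumOver-tabulate m suc (λ v → ind (is-nothing (lookup (nothing ∷ vec) v)) c)) (sum-is-nothing vec c))
  sum-is-nothing {m = suc m} (just x ∷ vec)  c =
    trans (sumOver-tabulate m suc (λ v → ind (is-nothing (lookup (just x ∷ vec) v)) c)) (sum-is-nothing vec c)

  roots≡nothings : ∀ {n} (p : Parents n) → roots p ≡ nothings p
  roots≡nothings {n} p = begin
    roots p
      ≡⟨ length-filter (λ v → is-nothing (lookup p v) ≟ᵇ true) (allFin n) ⟩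
    sumOver (allFin n) (λ v → ind (does (is-nothing (lookup p v) ≟ᵇ true)) 1)
      ≡⟨ sumOver-cong (allFin n) (λ v → cong (λ b → ind b 1) (does-≟-true (is-nothing (lookup p v)))) ⟩
    sumOver (allFin n) (λ v → ind (is-nothing (lookup p v)) 1)
      ≡⟨ sum-is-nothing p 1 ⟩
    nothings p * 1
      ≡⟨ ℕ.*-identityʳ _ ⟩
    nothings p ∎
    where
    does-≟-true : ∀ b → does (b ≟ᵇ true) ≡ b
    does-≟-true true  = refl
    does-≟-true false = refl

  sumToℕ-C-suc-head : ∀ c (h : ℕ → ℕ) → h 0 + sumToℕ c (λ j → (c C suc j) * h (suc j)) ≡ sumToℕ c (λ j → (c C j) * h j)
  sumToℕ-C-suc-head zero    h = trans (ℕ.+-identityʳ (h 0)) (sym (ℕ.*-identityˡ (h 0)))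
  sumToℕ-C-suc-head (suc c) h = begin
    h 0 + (sumToℕ c (λ j → (suc c C suc j) * h (suc j)) + (suc c C suc (suc c)) * h (suc (suc c)))
      ≡⟨ cong (λ z → h 0 + (sumToℕ c (λ j → (suc c C suc j) * h (suc j)) + z * h (suc (suc c)))) (k>n⇒nCk≡0 (ℕ.n<1+n (suc c))) ⟩
    h 0 + (sumToℕ c (λ j → (suc c C suc j) * h (suc j)) + 0)
      ≡⟨ cong₂ _+_ (sym (ℕ.*-identityˡ (h 0))) (ℕ.+-identityʳ _) ⟩
    1 * h 0 + sumToℕ c (λ j → (suc c C suc j) * h (suc j))
      ≡⟨ sumToℕ-suc-head c (λ j → (suc c C j) * h j) ⟨
    sumToℕ (suc c) (λ j → (suc c C j) * h j) ∎

  sumToℕ-pascal : ∀ c (h : ℕ → ℕ) →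
    sumToℕ (suc c) (λ j → (suc c C j) * h j) ≡ sumToℕ c (λ j → (c C j) * h (suc j)) + sumToℕ c (λ j → (c C j) * h j)
  sumToℕ-pascal c h = begin
    sumToℕ (suc c) (λ j → (suc c C j) * h j)
      ≡⟨ sumToℕ-suc-head c _ ⟩
    1 * h 0 + sumToℕ c (λ j → (suc c C suc j) * h (suc j))
      ≡⟨ cong₂ _+_ (ℕ.*-identityˡ (h 0)) (sumToℕ-cong c (λ j → cong (_* h (suc j)) (sym (nCk+nC[k+1]≡[n+1]C[k+1] c j)))) ⟩
    h 0 + sumToℕ c (λ j → ((c C j) + (c C suc j)) * h (suc j))
      ≡⟨ cong (h 0 +_) (trans (sumToℕ-cong c (λ j → ℕ.*-distribʳ-+ (h (suc j)) (c C j) (c C suc j))) (sumToℕ-+ c _ _)) ⟩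
    h 0 + (A + B)
      ≡⟨ solve 3 (λ x a b → x :+ (a :+ b) := a :+ (x :+ b)) refl (h 0) A B ⟩
    A + (h 0 + B)
      ≡⟨ cong (A +_) (sumToℕ-C-suc-head c h) ⟩
    A + sumToℕ c (λ j → (c C j) * h j) ∎
    where
    A = sumToℕ c (λ j → (c C j) * h (suc j))
    B = sumToℕ c (λ j → (c C suc j) * h (suc j))

  -- Attaching j of the c roots of q to the new vertex 0 leaves c − j + 1 roots, counted by binomial coefficients.
  sum-liftings-roots : ∀ {n m} (q : Vec (Maybe (Fin n)) m) (h : ℕ → ℕ) →
    sumOver (liftings q) (h ∘ nothings) ≡ sumToℕ (nothings q) (λ j → (nothings q C j) * h j)
  sum-liftings-roots []            h = trans (ℕ.+-identityʳ (h 0)) (sym (ℕ.*-identityˡ (h 0)))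
  sum-liftings-roots (nothing ∷ q) h = begin
    sumOver (liftings (nothing ∷ q)) (h ∘ nothings)
      ≡⟨ sum-liftings-nothing q (h ∘ nothings) ⟩
    sumOver (liftings q) (h ∘ suc ∘ nothings) + sumOver (liftings q) (h ∘ nothings)
      ≡⟨ cong₂ _+_ (sum-liftings-roots q (h ∘ suc)) (sum-liftings-roots q h) ⟩
    sumToℕ (nothings q) (λ j → (nothings q C j) * h (suc j)) + sumToℕ (nothings q) (λ j → (nothings q C j) * h j)
      ≡⟨ sumToℕ-pascal (nothings q) h ⟨
    sumToℕ (suc (nothings q)) (λ j → (suc (nothings q) C j) * h j) ∎
  sum-liftings-roots (just w ∷ q)  h = trans (sum-liftings-just q (h ∘ nothings) w) (sum-liftings-roots q h)

  sum-liftings-zeroChildless : ∀ {n m} (q : Vec (Maybe (Fin n)) m) (h : ℕ → ℕ) →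
    sumOver (liftings q) (λ tl → ind (zeroChildless tl) (h (nothings tl))) ≡ h (nothings q)
  sum-liftings-zeroChildless []            h = ℕ.+-identityʳ (h 0)
  sum-liftings-zeroChildless (nothing ∷ q) h =
    trans (sum-liftings-nothing q _)
          (trans (cong (sumOver (liftings q) (λ tl → ind (zeroChildless tl) (h (suc (nothings tl)))) +_) (sumOver-zero (liftings q)))
                 (trans (ℕ.+-identityʳ _) (sum-liftings-zeroChildless q (h ∘ suc))))
  sum-liftings-zeroChildless (just w ∷ q)  h = trans (sum-liftings-just q _ w) (sum-liftings-zeroChildless q h)

  weight : ∀ {k} → (ℕ → ℕ) → Parents k → ℕ
  weight g p = ind (good p) (g (roots p))

  forestSum : ℕ → (ℕ → ℕ) → ℕ
  forestSum n g = sumOver (allParents n n) (weight g)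

  module _ (n : ℕ) (g : ℕ → ℕ) where

    private
      W : ∀ {k} → Parents k → ℕ
      W = weight g

      S : Maybe (Fin (suc n)) → ℕ
      S x = sumOver (allParents (suc n) n) (W ∘ (x ∷_))

    -- vertex 0 is a root, with j of the c roots of the rest attached to it
    root-part : S nothing ≡ sumOver (allParents n n) (λ q → ind (good q) (sumToℕ (nothings q) (λ j → (nothings q C j) * g (suc j))))
    root-part = trans (sum-allParents-liftings n n (W ∘ (nothing ∷_))) (sumOver-cong (allParents n n) per-forest)
      where
      per-forest : ∀ q → sumOver (liftings q) (W ∘ (nothing ∷_)) ≡ ind (good q) (sumToℕ (nothings q) (λ j → (nothings q C j) * g (suc j)))
      per-forest q = begin
        sumOver (liftings q) (W ∘ (nothing ∷_))
          ≡⟨ sum-liftings-cong q (λ tl L → cong₂ ind (good-root q tl L) (cong g (roots≡nothings (nothing ∷ tl)))) ⟩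
        sumOver (liftings q) (λ tl → ind (good q) (g (suc (nothings tl))))
          ≡⟨ ind-sumOver (liftings q) (good q) _ ⟩
        ind (good q) (sumOver (liftings q) (g ∘ suc ∘ nothings))
          ≡⟨ cong (ind (good q)) (sum-liftings-roots q (g ∘ suc)) ⟩
        ind (good q) (sumToℕ (nothings q) (λ j → (nothings q C j) * g (suc j))) ∎

    loop-part : S (just zero) ≡ 0
    loop-part = trans (sumOver-cong (allParents (suc n) n) (λ tl → cong (λ b → ind b (g (roots (just zero ∷ tl)))) (good-loop tl)))
                      (sumOver-zero (allParents (suc n) n))

    -- vertex 0 is a leaf below one of the c roots of the rest
    leaf-part : sumOver (allFin n) (S ∘ just ∘ suc) ≡ sumOver (allParents n n) (λ q → ind (good q) (nothings q * g (nothings q)))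
    leaf-part = begin
      sumOver (allFin n) (S ∘ just ∘ suc)
        ≡⟨ sumOver-cong (allFin n) (λ i → trans (sum-allParents-liftings n n _) (sumOver-cong (allParents n n) (per-forest i))) ⟩
      sumOver (allFin n) (λ i → sumOver (allParents n n) (λ q → ind (good q) (ind (is-nothing (lookup q i)) (g (nothings q)))))
        ≡⟨ sumOver-swap (allFin n) (allParents n n) _ ⟩
      sumOver (allParents n n) (λ q → sumOver (allFin n) (λ i → ind (good q) (ind (is-nothing (lookup q i)) (g (nothings q)))))
        ≡⟨ sumOver-cong (allParents n n) (λ q → trans (ind-sumOver (allFin n) (good q) _) (cong (ind (good q)) (sum-is-nothing q _))) ⟩
      sumOver (allParents n n) (λ q → ind (good q) (nothings q * g (nothings q))) ∎
      where
      per-forest : ∀ i q → sumOver (liftings q) (W ∘ (just (suc i) ∷_)) ≡ ind (good q) (ind (is-nothing (lookup q i)) (g (nothings q)))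
      per-forest i q = begin
        sumOver (liftings q) (W ∘ (just (suc i) ∷_))
          ≡⟨ sum-liftings-cong q (λ tl L → trans (cong₂ ind (good-leaf q i tl L) (cong g (roots≡nothings (just (suc i) ∷ tl))))
                                                 (trans (ind-∧ (good q) _ _) (cong (ind (good q)) (ind-∧ (is-nothing (lookup q i)) _ _)))) ⟩
        sumOver (liftings q) (λ tl → ind (good q) (ind (is-nothing (lookup q i)) (ind (zeroChildless tl) (g (nothings tl)))))
          ≡⟨ ind-sumOver (liftings q) (good q) _ ⟩
        ind (good q) (sumOver (liftings q) (λ tl → ind (is-nothing (lookup q i)) (ind (zeroChildless tl) (g (nothings tl)))))
          ≡⟨ cong (ind (good q)) (trans (ind-sumOver (liftings q) _ _) (cong (ind (is-nothing (lookup q i))) (sum-liftings-zeroChildless q g))) ⟩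
        ind (good q) (ind (is-nothing (lookup q i)) (g (nothings q))) ∎

    forestSum-suc : forestSum (suc n) g ≡ forestSum n (λ r → r * g r + sumToℕ r (λ j → (r C j) * g (suc j)))
    forestSum-suc = begin
      forestSum (suc n) g
        ≡⟨ sum-allParents-suc (suc n) n W ⟩
      sumOver (entries (suc n)) S
        ≡⟨ sum-entries-suc n S ⟩
      (S nothing + S (just zero)) + sumOver (allFin n) (S ∘ just ∘ suc)
        ≡⟨ cong₂ _+_ (cong₂ _+_ root-part loop-part) leaf-part ⟩
      (Roots + 0) + Leaves
        ≡⟨ trans (cong (_+ Leaves) (ℕ.+-identityʳ Roots)) (ℕ.+-comm Roots Leaves) ⟩
      Leaves + Roots
        ≡⟨ sumOver-+ (allParents n n) _ _ ⟨
      sumOver (allParents n n) (λ q → ind (good q) (nothings q * g (nothings q))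
                                      + ind (good q) (sumToℕ (nothings q) (λ j → (nothings q C j) * g (suc j))))
        ≡⟨ sumOver-cong (allParents n n) (λ q → trans (sym (ind-+ (good q) _ _))
                        (cong (λ r → ind (good q) (r * g r + sumToℕ r (λ j → (r C j) * g (suc j)))) (sym (roots≡nothings q)))) ⟩
      forestSum n (λ r → r * g r + sumToℕ r (λ j → (r C j) * g (suc j))) ∎
      where
      Roots = sumOver (allParents n n) (λ q → ind (good q) (sumToℕ (nothings q) (λ j → (nothings q C j) * g (suc j))))
      Leaves = sumOver (allParents n n) (λ q → ind (good q) (nothings q * g (nothings q)))

  forestSum-cong : ∀ n {g h : ℕ → ℕ} → (∀ r → g r ≡ h r) → forestSum n g ≡ forestSum n h
  forestSum-cong n g≗h = sumOver-cong (allParents n n) (λ q → cong (ind (good q)) (g≗h (roots q)))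

  forestSum-+ : ∀ n (g h : ℕ → ℕ) → forestSum n (λ r → g r + h r) ≡ forestSum n g + forestSum n h
  forestSum-+ n g h = trans (sumOver-cong (allParents n n) (λ q → ind-+ (good q) (g (roots q)) (h (roots q))))
                            (sumOver-+ (allParents n n) (weight g) (weight h))

  forestSum-*ˡ : ∀ n c (g : ℕ → ℕ) → forestSum n (λ r → c * g r) ≡ c * forestSum n g
  forestSum-*ˡ n c g = trans (sumOver-cong (allParents n n) (λ q → ind-* (good q) c (g (roots q))))
                             (sym (sumOver-*ˡ c (allParents n n) (weight g)))

  forestSum-zero : ∀ n → forestSum n (λ _ → 0) ≡ 0
  forestSum-zero n = trans (sumOver-cong (allParents n n) (λ q → ind-zero (good q))) (sumOver-zero (allParents n n))

  forests : ℕ → ℕ → ℕ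
  forests n K = forestSum n (δ K)

  nothings≤length : ∀ {A : Set} {m} (v : Vec (Maybe A) m) → nothings v ≤ m
  nothings≤length []            = z≤n
  nothings≤length (nothing ∷ v) = s≤s (nothings≤length v)
  nothings≤length (just _ ∷ v)  = ℕ.m≤n⇒m≤1+n (nothings≤length v)

  forestSum-expand : ∀ n (g : ℕ → ℕ) → forestSum n g ≡ sumToℕ n (λ r → g r * forests n r)
  forestSum-expand n g = begin
    sumOver (allParents n n) (λ q → ind (good q) (g (roots q)))
      ≡⟨ sumOver-cong (allParents n n) (λ q → cong (ind (good q)) (sym (sumToℕ-δ-in n g (roots q) (roots≤n q)))) ⟩
    sumOver (allParents n n) (λ q → ind (good q) (sumToℕ n (λ r → g r * δ (roots q) r)))
      ≡⟨ sumOver-cong (allParents n n) (λ q → trans (ind-sumToℕ (good q) n _)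
           (sumToℕ-cong n (λ r → trans (ind-* (good q) (g r) _) (cong (λ z → g r * ind (good q) z) (δ-sym r (roots q)))))) ⟩
    sumOver (allParents n n) (λ q → sumToℕ n (λ r → g r * ind (good q) (δ r (roots q))))
      ≡⟨ sumOver-sumToℕ (allParents n n) n _ ⟩
    sumToℕ n (λ r → sumOver (allParents n n) (λ q → g r * ind (good q) (δ r (roots q))))
      ≡⟨ sumToℕ-cong n (λ r → sym (sumOver-*ˡ (g r) (allParents n n) _)) ⟩
    sumToℕ n (λ r → g r * forests n r) ∎
    where
    roots≤n : ∀ q → roots q ≤ n
    roots≤n q = subst (_≤ n) (sym (roots≡nothings q)) (nothings≤length q)
    δ-sym : ∀ r s → δ s r ≡ δ r s
    δ-sym r s with r ℕ.≟ s
    ... | yes refl = refl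
    ... | no r≢s   = trans (δ-≢ r≢s) (sym (δ-≢ (r≢s ∘ sym)))

  forests-suc-zero : ∀ n → forests (suc n) 0 ≡ 0
  forests-suc-zero n = trans (forestSum-suc n (δ 0)) (trans (forestSum-cong n no-trees) (forestSum-zero n))
    where
    no-trees : ∀ r → r * δ 0 r + sumToℕ r (λ j → (r C j) * 0) ≡ 0
    no-trees r = cong₂ _+_ (first r) (trans (sumToℕ-cong r (λ j → ℕ.*-zeroʳ (r C j))) (sumToℕ-zero r))
      where
      first : ∀ r → r * δ 0 r ≡ 0
      first zero    = refl
      first (suc r) = ℕ.*-zeroʳ (suc r)

  -- δ (suc K) (suc j) reduces to δ K j.
  forests-suc-suc : ∀ n K → forests (suc n) (suc K) ≡ suc K * forests n (suc K) + sumToℕ n (λ r → (r C K) * forests n r)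
  forests-suc-suc n K = begin
    forests (suc n) (suc K)
      ≡⟨ forestSum-suc n (δ (suc K)) ⟩
    forestSum n (λ r → r * δ (suc K) r + sumToℕ r (λ j → (r C j) * δ K j))
      ≡⟨ forestSum-cong n (λ r → cong₂ _+_ (scale r) (choose r)) ⟩
    forestSum n (λ r → suc K * δ (suc K) r + (r C K))
      ≡⟨ forestSum-+ n (λ r → suc K * δ (suc K) r) (_C K) ⟩
    forestSum n (λ r → suc K * δ (suc K) r) + forestSum n (_C K)
      ≡⟨ cong₂ _+_ (forestSum-*ˡ n (suc K) (δ (suc K))) (forestSum-expand n (_C K)) ⟩
    suc K * forests n (suc K) + sumToℕ n (λ r → (r C K) * forests n r) ∎
    where
    scale : ∀ r → r * δ (suc K) r ≡ suc K * δ (suc K) r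
    scale r with r ℕ.≟ suc K
    ... | yes refl = refl
    ... | no r≢K   = trans (cong (r *_) (δ-≢ r≢K)) (trans (ℕ.*-zeroʳ r) (sym (trans (cong (suc K *_) (δ-≢ r≢K)) (ℕ.*-zeroʳ (suc K)))))
    choose : ∀ r → sumToℕ r (λ j → (r C j) * δ K j) ≡ r C K
    choose r with K ℕ.≤? r
    ... | yes K≤r = sumToℕ-δ-in r (r C_) K K≤r
    ... | no K≰r  = trans (sumToℕ-δ-out r (r C_) K (ℕ.≰⇒> K≰r)) (sym (k>n⇒nCk≡0 (ℕ.≰⇒> K≰r)))

  forests-recurrence : ExponentialFormula.ForestRecurrence forests
  forests-recurrence = record
    { F-zero-zero = refl
    ; F-zero-suc  = λ _ → refl
    ; F-suc-zero  = forests-suc-zero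
    ; F-suc-suc   = forests-suc-suc
    }

  trees≡forests₁ : ∀ n → t S₀ n ≡ forests n 1
  trees≡forests₁ n = trans (length-filter (λ p → isRootedTree p ∧ avoids p S₀ ≟ᵇ true) (allParents n n))
    (sumOver-cong (allParents n n) (λ p → rooted-tree-indicator (does (roots p ℕ.≟ 1)) (acyclic p) (avoids p S₀)))
    where
    rooted-tree-indicator : ∀ a b c → ind (does (((a ∧ b) ∧ c) ≟ᵇ true)) 1 ≡ ind (b ∧ c) (ind a 1)
    rooted-tree-indicator true  true  true  = refl
    rooted-tree-indicator true  true  false = refl
    rooted-tree-indicator true  false c     = refl
    rooted-tree-indicator false true  true  = refl
    rooted-tree-indicator false true  false = refl
    rooted-tree-indicator false false c     = refl


proposition5p12 : (∀ n → D (egf (t S₀)) n ≡ (egf (t S₀) ⊕ expS (egf (t S₀))) n)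
    × egf (t S₀) 0 ≡ 0ℚ
proposition5p12 = egf-ode forests-recurrence (t S₀) trees≡forests₁
  where
  open ExponentialFormula using (egf-ode)
  open ForestCounting using (forests-recurrence; trees≡forests₁)
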